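{- Let $G$ be an undirected graph with Edmonds–Gallai decomposition $V=D(G)\cup A(G)\cup C(G)$. Let $\widetilde D(G)$ be the set of connected components of the subgraph induced by $D(G)$, each contracted to a pseudonode $z$ of size $s_z$ (its number of vertices). Form the network with a source $s$, sink $t$, arcs $s\to u$ of capacity $1$ for each $u\in A(G)$, arcs $u\to z$ of infinite capacity for each $u\in A(G)$ and $z\in\widetilde D(G)$ such that $u$ is adjacent in $G$ to some vertex of $z$, arcs $z\to t$ of infinite capacity with lower bound $\max\{0,s_z\lambda-s_z+1\}$ for each $z\in\widetilde D(G)$, and an arc $t\to s$ of infinite capacity. Then $\lambda$ is the maximal value for which this circulation problem is feasible if and only if $$\lambda\le\frac{|N^-(B)|+\sum_{z\in B}(s_z-1)}{\sum_{z\in B}s_z}\quad\text{for all } B\subseteq\widetilde D(G),$$ with equality for at least one subset $B\subseteq\widetilde D(G)$.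
   Context: Edmonds–Gallai decomposition: $D(G)$ is the set of vertices left uncovered by at least one maximum matching, $A(G)$ is the set of vertices not in $D(G)$ adjacent to some vertex of $D(G)$, and $C(G)=V\setminus(A(G)\cup D(G))$. $N^-(B)$ denotes the set of vertices $u\in A(G)$ having an arc $u\to z$ to some $z\in B$ in the network. A circulation is feasible if there is a flow conserving at every node and satisfying all lower and upper arc bounds.
   Formalization: The parameter λ ranges over the rationals, and both its maximality and the feasibility of the circulation are taken over rational values of λ and rational flows. -}

module Defs where

open import Data.Bool using (Bool; true; false; _∧_; _∨_; not; if_then_else_)
open import Data.Nat using (ℕ; zero; suc) renaming (_+_ to _+ℕ_; _≤_ to _≤ℕ_)
open import Data.Fin using (Fin; zero; suc; _↑ˡ_; _↑ʳ_; _≟_)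
open import Data.Integer using (+_)
open import Data.Rational using (ℚ; 0ℚ; 1ℚ; _+_; _*_; _-_; _≤_; _⊔_; _/_)
open import Data.List using (List; []; _∷_; _++_; concatMap; allFin; length; lookup)
open import Data.Maybe using (Maybe; just; nothing; is-just)
open import Data.Product using (Σ; _×_; ∃)
open import Relation.Binary.PropositionalEquality using (_≡_)
open import Relation.Binary.Construct.Closure.ReflexiveTransitive using (Star)
open import Relation.Nullary.Decidable using (⌊_⌋)
open import Function.Bundles using (_⇔_)

count : ∀ {m} → (Fin m → Bool) → ℕ
count {zero}  p = 0
count {suc m} p = (if p zero then 1 else 0) +ℕ count (λ i → p (suc i))

anyFin : ∀ {m} → (Fin m → Bool) → Bool
anyFin {zero}  p = false
anyFin {suc m} p = p zero ∨ anyFin (λ i → p (suc i))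

sumℚ : ∀ {m} → (Fin m → ℚ) → ℚ
sumℚ {zero}  f = 0ℚ
sumℚ {suc m} f = f zero + sumℚ (λ i → f (suc i))

ℕtoℚ : ℕ → ℚ
ℕtoℚ n = (+ n) / 1

_==_ : ∀ {m} → Fin m → Fin m → Bool
i == j = ⌊ i ≟ j ⌋

record Graph (n : ℕ) : Set where
  field
    adj     : Fin n → Fin n → Bool
    adj-sym : ∀ u v → adj u v ≡ adj v u
    irrefl  : ∀ v → adj v v ≡ false
open Graph public

-- A matching, encoded by its partner map: m u ≡ just v iff uv ∈ M.
IsMatching : ∀ {n} → Graph n → (Fin n → Maybe (Fin n)) → Set
IsMatching G m = ∀ u v → m u ≡ just v → (adj G u v ≡ true) × (m v ≡ just u)

-- number of vertices covered by the matching (= 2 · number of edges)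
covered : ∀ {n} → (Fin n → Maybe (Fin n)) → ℕ
covered m = count (λ v → is-just (m v))

IsMaximumMatching : ∀ {n} → Graph n → (Fin n → Maybe (Fin n)) → Set
IsMaximumMatching G m =
  IsMatching G m × (∀ m' → IsMatching G m' → covered m' ≤ℕ covered m)

InD : ∀ {n} → Graph n → Fin n → Set
InD G v = Σ _ λ m → IsMaximumMatching G m × (m v ≡ nothing)

inA : ∀ {n} → Graph n → (Fin n → Bool) → Fin n → Bool
inA G d u = not (d u) ∧ anyFin (λ w → d w ∧ adj G u w)

EdgeD : ∀ {n} → Graph n → (Fin n → Bool) → Fin n → Fin n → Set
EdgeD G d u v = (d u ≡ true) × (d v ≡ true) × (adj G u v ≡ true)

ConnD : ∀ {n} → Graph n → (Fin n → Bool) → Fin n → Fin n → Set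
ConnD G d = Star (EdgeD G d)

-- cl labels the connected components of G[D] bijectively by Fin k
-- (values of cl outside D are irrelevant).
IsComponentLabelling : ∀ {n k} → Graph n → (Fin n → Bool) → (Fin n → Fin k) → Set
IsComponentLabelling G d cl =
  (∀ u v → d u ≡ true → d v ≡ true → ((cl u ≡ cl v) ⇔ ConnD G d u v))
  × (∀ z → ∃ λ v → (d v ≡ true) × (cl v ≡ z))

module Decomp {n k : ℕ} (G : Graph n) (d : Fin n → Bool) (cl : Fin n → Fin k) where

  size : Fin k → ℕ
  size z = count (λ v → d v ∧ (cl v == z))

  adjComp : Fin n → Fin k → Bool
  adjComp u z = anyFin (λ w → d w ∧ (cl w == z) ∧ adj G u w)

  N⁻ : (Fin k → Bool) → ℕ
  N⁻ B = count (λ u → inA G d u ∧ anyFin (λ z → B z ∧ adjComp u z))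

  sumSize : (Fin k → Bool) → ℚ
  sumSize B = sumℚ (λ z → if B z then ℕtoℚ (size z) else 0ℚ)

  sumSize-1 : (Fin k → Bool) → ℚ
  sumSize-1 B = sumℚ (λ z → if B z then ℕtoℚ (size z) - 1ℚ else 0ℚ)

record Arc (N : ℕ) : Set where
  constructor arc
  field
    src dst : Fin N
    lower   : ℚ
    upper   : Maybe ℚ   -- nothing = infinite capacity
open Arc public

Network : ℕ → Set
Network N = List (Arc N)

UpperOK : Maybe ℚ → ℚ → Set
UpperOK nothing  x = Data.Unit.⊤ where import Data.Unit
UpperOK (just c) x = x ≤ c

inflow : ∀ {N} (net : Network N) → (Fin (length net) → ℚ) → Fin N → ℚ
inflow net f v = sumℚ (λ e → if dst (lookup net e) == v then f e else 0ℚ)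

outflow : ∀ {N} (net : Network N) → (Fin (length net) → ℚ) → Fin N → ℚ
outflow net f v = sumℚ (λ e → if src (lookup net e) == v then f e else 0ℚ)

IsCirculation : ∀ {N} (net : Network N) → (Fin (length net) → ℚ) → Set
IsCirculation net f =
  (∀ e → (lower (lookup net e) ≤ f e) × UpperOK (upper (lookup net e)) (f e))
  × (∀ v → inflow net f v ≡ outflow net f v)

Feasible : ∀ {N} → Network N → Set
Feasible net = Σ _ (IsCirculation net)

-- The network of the lemma. Nodes: s = 0, t = 1, then vertices u of G
-- (only those in A(G) carry arcs), then pseudonodes z ∈ D̃(G).

module EGNetwork {n k : ℕ} (G : Graph n) (d : Fin n → Bool) (cl : Fin n → Fin k) where
  open Decomp G d cl

  Node : Set
  Node = Fin (suc (suc (n +ℕ k)))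

  sN tN : Node
  sN = zero
  tN = suc zero

  vN : Fin n → Node
  vN u = suc (suc (u ↑ˡ k))

  zN : Fin k → Node
  zN z = suc (suc (n ↑ʳ z))

  network : ℚ → Network (suc (suc (n +ℕ k)))
  network lam =
       concatMap (λ u → if inA G d u then arc sN (vN u) 0ℚ (just 1ℚ) ∷ [] else []) (allFin n)
    ++ concatMap (λ u → concatMap (λ z →
          if inA G d u ∧ adjComp u z then arc (vN u) (zN z) 0ℚ nothing ∷ [] else [])
          (allFin k)) (allFin n)
    ++ concatMap (λ z → arc (zN z) tN
          (0ℚ ⊔ ((ℕtoℚ (size z) * lam - ℕtoℚ (size z)) + 1ℚ)) nothing ∷ []) (allFin k)
    ++ arc tN sN 0ℚ nothing ∷ []

  IsMaxFeasible : ℚ → Set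
  IsMaxFeasible lam = Feasible (network lam) × (∀ μ → Feasible (network μ) → μ ≤ lam)

  NonemptyB : (Fin k → Bool) → Set
  NonemptyB B = anyFin B ≡ true

  -- λ ≤ (|N⁻(B)| + Σ_{z∈B}(s_z - 1)) / Σ_{z∈B} s_z, cleared of the
  -- (positive, for nonempty B) denominator
  BoundHolds : ℚ → (Fin k → Bool) → Set
  BoundHolds lam B = lam * sumSize B ≤ ℕtoℚ (N⁻ B) + sumSize-1 B

  BoundTight : ℚ → (Fin k → Bool) → Set
  BoundTight lam B = lam * sumSize B ≡ ℕtoℚ (N⁻ B) + sumSize-1 B

{-# OPTIONS --safe #-}
module Submission where

-- For fixed λ, the network carries a circulation iff the lower bounds ℓ_z = max {0, s_z λ - s_z + 1} of the
-- arcs z → t can be routed from the vertices of A(G), each supplying at most one unit, along the arcs u → z.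
-- That is a fractional transportation problem, solvable iff Hall's condition Σ_{z∈B} ℓ_z ≤ |N⁻(B)| holds
-- for every B: necessity is the cut condition for the cut N⁻(B) ∪ B, sufficiency is proved by pushing flow
-- along one edge as far as Hall's condition allows and splitting the problem along the tight set that may
-- appear. As ℓ_z is the positive part of s_z λ - s_z + 1, Hall's condition for all B amounts to
-- λ ≤ r(B) = (|N⁻(B)| + Σ_{z∈B} (s_z - 1)) / Σ_{z∈B} s_z for all nonempty B. So the feasible λ are those
-- below min_B r(B), and the largest of them is this minimum, attained at a minimising B.

open import Algebra.Bundles using (Ring)
open import Data.Bool using (Bool; true; false; _∧_; _∨_; not; if_then_else_)
import Data.Bool as Bool
open import Data.Bool.Properties using (∨-zeroʳ; ∧-identityʳ)
open import Data.Empty using (⊥-elim)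
open import Data.Fin using (Fin; zero; suc; _≟_; splitAt)
import Data.Fin.Properties as Fin
import Data.Integer as ℤ
import Data.Integer.Properties as ℤ
open import Data.List using (List; []; _∷_; _++_; map; filter; length; lookup; concatMap; tabulate; allFin)
open import Data.List.Membership.Propositional using (_∈_)
open import Data.List.Membership.Propositional.Properties
  using (∈-lookup; ∈-map⁺; ∈-map⁻; ∈-++⁺ˡ; ∈-++⁺ʳ; ∈-filter⁺; ∈-filter⁻)
open import Data.List.Relation.Unary.All using (All; []; _∷_)
import Data.List.Relation.Unary.All as All
open import Data.List.Relation.Unary.All.Properties using (all-filter; map⁺; map⁻; ++⁺; concat⁺; tabulate⁺)
open import Data.List.Relation.Unary.Any using (here; there)
open import Data.Maybe using (Maybe; just; nothing)
open import Data.Nat using (ℕ; zero; suc; z≤n; s≤s) renaming (_+_ to _+ℕ_; _≤_ to _≤ℕ_; _<_ to _<ℕ_)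
open import Data.Nat.Induction using (<-wellFounded)
import Data.Nat.Properties as ℕ
open import Data.Product using (∃; ∃-syntax; _×_; _,_; proj₁; proj₂)
open import Data.Rational
  using (ℚ; 0ℚ; 1ℚ; _+_; _*_; _-_; -_; _≤_; _<_; _⊔_; 1/_; toℚᵘ; ≢-nonZero; positive; nonNegative)
open import Data.Rational.Properties hiding (_≟_)
open import Data.Rational.Properties using () renaming (_≟_ to _≟ℚ_)
open import Data.Rational.Solver using (module +-*-Solver)
import Data.Rational.Unnormalised as ℚᵘ
import Data.Rational.Unnormalised.Properties as ℚᵘ
open import Data.Sum using (_⊎_; inj₁; inj₂; [_,_]′)
open import Data.Unit using (tt)
open import Data.Vec.Functional using () renaming (_∷_ to _◂_)
open import Function using (_∘_; id; case_of_)
open import Function.Bundles using (_⇔_; mk⇔; Equivalence)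
import Function.Properties.Equivalence as ⇔
open import Induction.WellFounded using (Acc; acc)
open import Level using (0ℓ)
open import Relation.Binary.Bundles using (DecTotalOrder)
open import Relation.Binary.PropositionalEquality
open import Relation.Nullary using (¬_; Dec; yes; no; does)
open import Relation.Nullary.Decidable using (_×-dec_; dec-true; dec-false; isYes≗does; decidable-stable)
open import Relation.Unary using (Pred; Decidable)

open import Defs
open import Algebra.Properties.Semiring.Sum (Ring.semiring +-*-ring)
  using (sum; sum-cong-≗; ∑-distrib-+; ∑-comm; *-distribˡ-sum; sum-replicate-zero)
open import Data.List.Extrema (DecTotalOrder.totalOrder ≤-decTotalOrder)
  using (argmin; argmin-all; argmin-sel; f[argmin]≤f[⊤]; f[argmin]≤f[xs]; min; min≤⊤; min≤xs; v≤min⁺)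

private
  variable
    m k : ℕ

==-refl : (i : Fin m) → (i == i) ≡ true
==-refl i = trans (isYes≗does (i ≟ i)) (dec-true (i ≟ i) refl)

==-≢ : {i j : Fin m} → i ≢ j → (i == j) ≡ false
==-≢ {i = i} {j} i≢j = trans (isYes≗does (i ≟ j)) (dec-false (i ≟ j) i≢j)

==⇒≡ : {i j : Fin m} → (i == j) ≡ true → i ≡ j
==⇒≡ {i = i} {j} eq with i ≟ j
... | yes i≡j = i≡j
==⇒≡ () | no _

true≢false : true ≢ false
true≢false ()

∧-intro : ∀ {a b} → a ≡ true → b ≡ true → (a ∧ b) ≡ true
∧-intro refl refl = refl

∧-elimˡ : ∀ {a b} → (a ∧ b) ≡ true → a ≡ true
∧-elimˡ {true} _ = refl

∧-elimʳ : ∀ {a b} → (a ∧ b) ≡ true → b ≡ true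
∧-elimʳ {true} eq = eq

infix 4 _⊆_
_⊆_ : (p q : Fin m → Bool) → Set
p ⊆ q = ∀ i → p i ≡ true → q i ≡ true

anyFin-witness : (p : Fin m → Bool) → anyFin p ≡ true → ∃[ i ] p i ≡ true
anyFin-witness {suc m} p eq with p zero in p₀
... | true  = zero , p₀
... | false = let i , pᵢ = anyFin-witness (p ∘ suc) eq in suc i , pᵢ

anyFin-intro : (p : Fin m → Bool) (i : Fin m) → p i ≡ true → anyFin p ≡ true
anyFin-intro p zero    pᵢ rewrite pᵢ = refl
anyFin-intro p (suc i) pᵢ with p zero
... | true  = refl
... | false = anyFin-intro (p ∘ suc) i pᵢ

anyFin-false : (p : Fin m → Bool) → anyFin p ≡ false → ∀ i → p i ≡ false
anyFin-false p none i with p i in pᵢ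
... | false = refl
... | true  = trans (sym (anyFin-intro p i pᵢ)) none

anyFin-cong : {p q : Fin m → Bool} → p ≗ q → anyFin p ≡ anyFin q
anyFin-cong {zero}  p≗q = refl
anyFin-cong {suc m} p≗q = cong₂ _∨_ (p≗q zero) (anyFin-cong (p≗q ∘ suc))

count-cong : {p q : Fin m → Bool} → p ≗ q → count p ≡ count q
count-cong {zero}  p≗q = refl
count-cong {suc m} p≗q = cong₂ (λ b c → (if b then 1 else 0) +ℕ c) (p≗q zero) (count-cong (p≗q ∘ suc))

indicator-mono : ∀ {a b} → (a ≡ true → b ≡ true) → (if a then 1 else 0) ≤ℕ (if b then 1 else 0)
indicator-mono {false}         a⇒b = z≤n
indicator-mono {true}  {true}  a⇒b = ℕ.≤-refl
indicator-mono {true}  {false} a⇒b = ⊥-elim (true≢false (sym (a⇒b refl)))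

count-mono : {p q : Fin m → Bool} → p ⊆ q → count p ≤ℕ count q
count-mono {zero}  p⊆q = z≤n
count-mono {suc m} p⊆q = ℕ.+-mono-≤ (indicator-mono (p⊆q zero)) (count-mono (p⊆q ∘ suc))

count-< : {p q : Fin m → Bool} → p ⊆ q → (j : Fin m) → p j ≡ false → q j ≡ true → count p <ℕ count q
count-< p⊆q zero    pⱼ qⱼ rewrite pⱼ | qⱼ = s≤s (count-mono (p⊆q ∘ suc))
count-< p⊆q (suc j) pⱼ qⱼ = ℕ.+-mono-≤-< (indicator-mono (p⊆q zero)) (count-< (p⊆q ∘ suc) j pⱼ qⱼ)

count-pos : {p : Fin m → Bool} (j : Fin m) → p j ≡ true → 0 <ℕ count p
count-pos         zero    pⱼ rewrite pⱼ = s≤s z≤n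
count-pos {p = p} (suc j) pⱼ = ℕ.<-≤-trans (count-pos j pⱼ) (ℕ.m≤n+m _ (if p zero then 1 else 0))

module _ where
  open +-*-Solver

  x-y+y≡x : ∀ x y → x - y + y ≡ x
  x-y+y≡x = solve 2 (λ x y → x :- y :+ y := x) refl

  x+y-y≡x : ∀ x y → x + y - y ≡ x
  x+y-y≡x = solve 2 (λ x y → x :+ y :- y := x) refl

  x+[y-x]≡y : ∀ x y → x + (y - x) ≡ y
  x+[y-x]≡y = solve 2 (λ x y → x :+ (y :- x) := y) refl

  x-[x-y]≡y : ∀ x y → x - (x - y) ≡ y
  x-[x-y]≡y = solve 2 (λ x y → x :- (x :- y) := y) refl

  [x-y]+[z-w]≡[x+z]-[y+w] : ∀ x y z w → (x - y) + (z - w) ≡ (x + z) - (y + w)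
  [x-y]+[z-w]≡[x+z]-[y+w] = solve 4 (λ x y z w → (x :- y) :+ (z :- w) := (x :+ z) :- (y :+ w)) refl

  [x-y]*z≡x*z-y*z : ∀ x y z → (x - y) * z ≡ x * z - y * z
  [x-y]*z≡x*z-y*z = solve 3 (λ x y z → (x :- y) :* z := x :* z :- y :* z) refl

x≤y⇒0≤y-x : ∀ {x y} → x ≤ y → 0ℚ ≤ y - x
x≤y⇒0≤y-x {x} {y} x≤y = subst (_≤ y - x) (+-inverseʳ x) (+-monoˡ-≤ (- x) x≤y)

0≤y-x⇒x≤y : ∀ {x y} → 0ℚ ≤ y - x → x ≤ y
0≤y-x⇒x≤y {x} {y} 0≤y-x = subst₂ _≤_ (+-identityˡ x) (x-y+y≡x y x) (+-monoˡ-≤ x 0≤y-x)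

0≤y⇒x-y≤x : ∀ x {y} → 0ℚ ≤ y → x - y ≤ x
0≤y⇒x-y≤x x {y} 0≤y = subst (x - y ≤_) (+-identityʳ x) (+-monoʳ-≤ x (neg-antimono-≤ 0≤y))

δ≤y-x⇒x≤y-δ : ∀ {x y δ} → δ ≤ y - x → x ≤ y - δ
δ≤y-x⇒x≤y-δ {x} {y} {δ} δ≤y-x =
  subst₂ _≤_ (x+y-y≡x x δ) (cong (_- δ) (x+[y-x]≡y x y)) (+-monoˡ-≤ (- δ) (+-monoʳ-≤ x δ≤y-x))

+-cancelʳ-≤ : ∀ {x y} r → x + r ≤ y + r → x ≤ y
+-cancelʳ-≤ {x} {y} r x+r≤y+r = subst₂ _≤_ (x+y-y≡x x r) (x+y-y≡x y r) (+-monoˡ-≤ (- r) x+r≤y+r)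

-- n / 1 is normalised by a gcd computation that is stuck for variable n, so this is checked in ℚᵘ.
ℕtoℚ-suc : ∀ n → ℕtoℚ (suc n) ≡ 1ℚ + ℕtoℚ n
ℕtoℚ-suc n = toℚᵘ-injective (begin
    toℚᵘ (ℕtoℚ (suc n))             ≈⟨ toℚᵘ-fromℚᵘ (ℚᵘ.mkℚᵘ (ℤ.+ suc n) 0) ⟩
    ℚᵘ.mkℚᵘ (ℤ.+ suc n) 0
      ≈⟨ ℚᵘ.*≡* (cong (λ t → (ℤ.+ 1 ℤ.+ t) ℤ.* ℤ.+ 1) (sym (ℤ.*-identityʳ (ℤ.+ n)))) ⟩
    ℚᵘ.1ℚᵘ ℚᵘ.+ ℚᵘ.mkℚᵘ (ℤ.+ n) 0
      ≈⟨ ℚᵘ.+-congʳ ℚᵘ.1ℚᵘ (ℚᵘ.≃-sym (toℚᵘ-fromℚᵘ (ℚᵘ.mkℚᵘ (ℤ.+ n) 0))) ⟩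
    toℚᵘ 1ℚ ℚᵘ.+ toℚᵘ (ℕtoℚ n)      ≈⟨ ℚᵘ.≃-sym (toℚᵘ-homo-+ 1ℚ (ℕtoℚ n)) ⟩
    toℚᵘ (1ℚ + ℕtoℚ n)              ∎)
  where open import Relation.Binary.Reasoning.Setoid ℚᵘ.≃-setoid

ℕtoℚ-nonneg : ∀ n → 0ℚ ≤ ℕtoℚ n
ℕtoℚ-nonneg zero    = ≤-refl
ℕtoℚ-nonneg (suc n) = subst (0ℚ ≤_) (sym (ℕtoℚ-suc n)) (+-mono-≤ (nonNegative⁻¹ 1ℚ) (ℕtoℚ-nonneg n))

ℕtoℚ-pos : ∀ {n} → 0 <ℕ n → 0ℚ < ℕtoℚ n
ℕtoℚ-pos {suc n} _ = subst (0ℚ <_) (sym (ℕtoℚ-suc n)) (+-mono-<-≤ (positive⁻¹ 1ℚ) (ℕtoℚ-nonneg n))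

ind : Bool → ℚ
ind b = if b then 1ℚ else 0ℚ

ind-nonneg : ∀ b → 0ℚ ≤ ind b
ind-nonneg true  = nonNegative⁻¹ 1ℚ
ind-nonneg false = ≤-refl

if-as-product : ∀ b x → (if b then x else 0ℚ) ≡ ind b * x
if-as-product true  x = sym (*-identityˡ x)
if-as-product false x = sym (*-zeroˡ x)

if-zero : ∀ b → (if b then 0ℚ else 0ℚ) ≡ 0ℚ
if-zero true  = refl
if-zero false = refl

positive? : ℚ → Bool
positive? x = does (0ℚ <? x)

positive?-sound : ∀ {x} → positive? x ≡ true → 0ℚ < x
positive?-sound {x} eq =
  decidable-stable (0ℚ <? x) (λ x≯0 → true≢false (trans (sym eq) (dec-false (0ℚ <? x) x≯0)))

0⊔-positive-part : ∀ x → 0ℚ ⊔ x ≡ (if positive? x then x else 0ℚ)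
0⊔-positive-part x = by-cases (0ℚ <? x)
  where
  by-cases : (0<x? : Dec (0ℚ < x)) → 0ℚ ⊔ x ≡ (if does 0<x? then x else 0ℚ)
  by-cases (yes 0<x) = p≤q⇒p⊔q≡q (<⇒≤ 0<x)
  by-cases (no  0≮x) = p≥q⇒p⊔q≡p (≮⇒≥ 0≮x)

-- 1/q, with the junk value 1/0 = 0
inverse : ℚ → ℚ
inverse q with q ≟ℚ 0ℚ
... | yes _   = 0ℚ
... | no  q≢0 = 1/_ q {{≢-nonZero q≢0}}

inverse-inverseˡ : ∀ {q} → 0ℚ < q → inverse q * q ≡ 1ℚ
inverse-inverseˡ {q} 0<q with q ≟ℚ 0ℚ
... | yes q≡0 = ⊥-elim (<-irrefl (sym q≡0) 0<q)
... | no  q≢0 = *-inverseˡ q {{≢-nonZero q≢0}}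

sumℚ≡sum : (f : Fin m → ℚ) → sumℚ f ≡ sum f
sumℚ≡sum {zero}  f = refl
sumℚ≡sum {suc m} f = cong (f zero +_) (sumℚ≡sum (f ∘ suc))

sumℚ-cong : {f g : Fin m → ℚ} → f ≗ g → sumℚ f ≡ sumℚ g
sumℚ-cong {f = f} {g} f≗g = trans (sumℚ≡sum f) (trans (sum-cong-≗ f≗g) (sym (sumℚ≡sum g)))

sum-zero : {f : Fin m → ℚ} → (∀ i → f i ≡ 0ℚ) → sum f ≡ 0ℚ
sum-zero {m} f≡0 = trans (sum-cong-≗ f≡0) (sum-replicate-zero m)

sum-mono : {f g : Fin m → ℚ} → (∀ i → f i ≤ g i) → sum f ≤ sum g
sum-mono {zero}  f≤g = ≤-refl
sum-mono {suc m} f≤g = +-mono-≤ (f≤g zero) (sum-mono (f≤g ∘ suc))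

sum-nonneg : {f : Fin m → ℚ} → (∀ i → 0ℚ ≤ f i) → 0ℚ ≤ sum f
sum-nonneg {m} {f} 0≤f = subst (_≤ sum f) (sum-replicate-zero m) (sum-mono 0≤f)

∑-distrib-- : (f g : Fin m → ℚ) → sum (λ i → f i - g i) ≡ sum f - sum g
∑-distrib-- {zero}  f g = refl
∑-distrib-- {suc m} f g = trans (cong (f zero - g zero +_) (∑-distrib-- (f ∘ suc) (g ∘ suc)))
                                ([x-y]+[z-w]≡[x+z]-[y+w] (f zero) (g zero) (sum (f ∘ suc)) (sum (g ∘ suc)))

sum-supported : {f : Fin m → ℚ} (j : Fin m) → (∀ i → j ≢ i → f i ≡ 0ℚ) → sum f ≡ f j
sum-supported {suc m} {f} zero off =
  trans (cong (f zero +_) (sum-zero (λ i → off (suc i) λ ()))) (+-identityʳ (f zero))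
sum-supported {suc m} {f} (suc j) off =
  trans (cong (_+ sum (f ∘ suc)) (off zero λ ()))
        (trans (+-identityˡ _) (sum-supported j (λ i j≢i → off (suc i) (j≢i ∘ Fin.suc-injective))))

sum-sift : (j : Fin m) (f : Fin m → ℚ) → sum (λ i → if j == i then f i else 0ℚ) ≡ f j
sum-sift j f = trans (sum-supported j off) (cong (λ b → if b then f j else 0ℚ) (==-refl j))
  where
  off : ∀ i → j ≢ i → (if j == i then f i else 0ℚ) ≡ 0ℚ
  off i j≢i rewrite ==-≢ j≢i = refl

sum-pos-witness : {f : Fin m → ℚ} → 0ℚ < sum f → ∃[ i ] 0ℚ < f i
sum-pos-witness {m} {f} 0<Σf with Fin.any? (λ i → 0ℚ <? f i)
... | yes found = found
... | no  none  = ⊥-elim (<-irrefl refl (<-≤-trans 0<Σf Σf≤0))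
  where
  Σf≤0 : sum f ≤ 0ℚ
  Σf≤0 = subst (sum f ≤_) (sum-replicate-zero m) (sum-mono (λ i → ≮⇒≥ (λ 0<fᵢ → none (i , 0<fᵢ))))

sum-regroup : ∀ {V} (key : Fin m → Fin V) (g : Fin V → ℚ) (f : Fin m → ℚ) →
              sum (λ v → g v * sum (λ e → if key e == v then f e else 0ℚ)) ≡ sum (λ e → g (key e) * f e)
sum-regroup key g f = begin
  sum (λ v → g v * sum (λ e → if key e == v then f e else 0ℚ))
    ≡⟨ sum-cong-≗ (λ v → *-distribˡ-sum (g v) (λ e → if key e == v then f e else 0ℚ)) ⟩
  sum (λ v → sum (λ e → g v * (if key e == v then f e else 0ℚ)))
    ≡⟨ ∑-comm (λ v e → g v * (if key e == v then f e else 0ℚ)) ⟩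
  sum (λ e → sum (λ v → g v * (if key e == v then f e else 0ℚ)))
    ≡⟨ sum-cong-≗ (λ e → trans (sum-cong-≗ (pull e)) (sum-sift (key e) (λ v → g v * f e))) ⟩
  sum (λ e → g (key e) * f e) ∎
  where
  open ≡-Reasoning
  pull : ∀ e v → g v * (if key e == v then f e else 0ℚ) ≡ (if key e == v then g v * f e else 0ℚ)
  pull e v with key e == v
  ... | true  = refl
  ... | false = *-zeroʳ (g v)

restrict : (Fin m → Bool) → (Fin m → ℚ) → Fin m → ℚ
restrict p f i = if p i then f i else 0ℚ

sumOver : (Fin m → Bool) → (Fin m → ℚ) → ℚ
sumOver p f = sum (restrict p f)

module _ {p : Fin m → Bool} {f : Fin m → ℚ} where

  restrict-nonneg : (∀ i → 0ℚ ≤ f i) → ∀ i → 0ℚ ≤ restrict p f i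
  restrict-nonneg 0≤f i with p i
  ... | true  = 0≤f i
  ... | false = ≤-refl

  restrict-≤ : (∀ i → 0ℚ ≤ f i) → ∀ i → restrict p f i ≤ f i
  restrict-≤ 0≤f i with p i
  ... | true  = ≤-refl
  ... | false = 0≤f i

  sumOver-pos-witness : 0ℚ < sumOver p f → ∃[ i ] p i ≡ true × 0ℚ < f i
  sumOver-pos-witness 0<Σ with sum-pos-witness 0<Σ
  ... | i , 0<fᵢ with p i in pᵢ
  ...   | true  = i , pᵢ , 0<fᵢ
  ...   | false = ⊥-elim (<-irrefl refl 0<fᵢ)

restrict-off : (p : Fin m → Bool) (f : Fin m → ℚ) {i : Fin m} → p i ≡ false → restrict p f i ≡ 0ℚ
restrict-off p f {i} pᵢ = cong (λ b → if b then f i else 0ℚ) pᵢ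

restrict-split : (p : Fin m → Bool) (f : Fin m → ℚ) → ∀ i → restrict p f i + restrict (not ∘ p) f i ≡ f i
restrict-split p f i with p i
... | true  = +-identityʳ (f i)
... | false = +-identityˡ (f i)

sumOver-cong : {p q : Fin m → Bool} {f g : Fin m → ℚ} → p ≗ q → f ≗ g → sumOver p f ≡ sumOver q g
sumOver-cong p≗q f≗g = sum-cong-≗ (λ i → cong₂ (λ b x → if b then x else 0ℚ) (p≗q i) (f≗g i))

sumOver-zero : (p : Fin m → Bool) {f : Fin m → ℚ} → (∀ i → p i ≡ true → f i ≡ 0ℚ) → sumOver p f ≡ 0ℚ
sumOver-zero p {f} f≡0 = sum-zero pointwise
  where
  pointwise : ∀ i → restrict p f i ≡ 0ℚ
  pointwise i with p i in pᵢ
  ... | true  = f≡0 i pᵢ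
  ... | false = refl

sumOver-supported : (p : Fin m → Bool) {f : Fin m → ℚ} → (∀ i → p i ≡ false → f i ≡ 0ℚ) → sumOver p f ≡ sum f
sumOver-supported p {f} f≡0 = sum-cong-≗ pointwise
  where
  pointwise : ∀ i → restrict p f i ≡ f i
  pointwise i with p i in pᵢ
  ... | true  = refl
  ... | false = sym (f≡0 i pᵢ)

sumOver-mono : {p q : Fin m → Bool} {f : Fin m → ℚ} → (∀ i → 0ℚ ≤ f i) → p ⊆ q → sumOver p f ≤ sumOver q f
sumOver-mono {p = p} {q} {f} 0≤f p⊆q = sum-mono pointwise
  where
  pointwise : ∀ i → restrict p f i ≤ restrict q f i
  pointwise i with p i in pᵢ | q i in qᵢ
  ... | false | false = ≤-refl
  ... | false | true  = 0≤f i
  ... | true  | true  = ≤-refl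
  ... | true  | false = ⊥-elim (true≢false (trans (sym (p⊆q i pᵢ)) qᵢ))

sumOver-monoʳ : (p : Fin m → Bool) {f g : Fin m → ℚ} → (∀ i → f i ≤ g i) → sumOver p f ≤ sumOver p g
sumOver-monoʳ p {f} {g} f≤g = sum-mono pointwise
  where
  pointwise : ∀ i → restrict p f i ≤ restrict p g i
  pointwise i with p i
  ... | true  = f≤g i
  ... | false = ≤-refl

sumOver-≥-term : {p : Fin m → Bool} {f : Fin m → ℚ} → (∀ i → 0ℚ ≤ f i) →
                 ∀ {j} → p j ≡ true → f j ≤ sumOver p f
sumOver-≥-term {p = p} {f} 0≤f {j} pⱼ = subst (_≤ sumOver p f) (sum-sift j f)
  (sumOver-mono 0≤f (λ i j≡i → subst (λ i → p i ≡ true) (==⇒≡ j≡i) pⱼ))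

sumOver-restrict : (p q : Fin m → Bool) (f : Fin m → ℚ) → sumOver p (restrict q f) ≡ sumOver (λ i → p i ∧ q i) f
sumOver-restrict p q f = sum-cong-≗ pointwise
  where
  pointwise : ∀ i → restrict p (restrict q f) i ≡ restrict (λ i → p i ∧ q i) f i
  pointwise i with p i
  ... | true  = refl
  ... | false = refl

sumOver-∨ : (p q : Fin m → Bool) (f : Fin m → ℚ) →
            sumOver (λ i → p i ∨ q i) f ≡ sumOver (λ i → p i ∧ not (q i)) f + sumOver q f
sumOver-∨ p q f = trans (sum-cong-≗ pointwise) (∑-distrib-+ (restrict (λ i → p i ∧ not (q i)) f) (restrict q f))
  where
  pointwise : ∀ i → restrict (λ i → p i ∨ q i) f i ≡ restrict (λ i → p i ∧ not (q i)) f i + restrict q f i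
  pointwise i with p i | q i
  ... | true  | true  = sym (+-identityˡ (f i))
  ... | true  | false = sym (+-identityʳ (f i))
  ... | false | true  = sym (+-identityˡ (f i))
  ... | false | false = refl

sumOver-- : (p : Fin m → Bool) (f g : Fin m → ℚ) → sumOver p (λ i → f i - g i) ≡ sumOver p f - sumOver p g
sumOver-- p f g = trans (sum-cong-≗ pointwise) (∑-distrib-- (restrict p f) (restrict p g))
  where
  pointwise : ∀ i → restrict p (λ i → f i - g i) i ≡ restrict p f i - restrict p g i
  pointwise i with p i
  ... | true  = refl
  ... | false = refl

ℕtoℚ-count : (p : Fin m → Bool) → ℕtoℚ (count p) ≡ sumOver p (λ _ → 1ℚ)
ℕtoℚ-count {zero}  p = refl
ℕtoℚ-count {suc m} p with p zero
... | true  = trans (ℕtoℚ-suc (count (p ∘ suc))) (cong (1ℚ +_) (ℕtoℚ-count (p ∘ suc)))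
... | false = trans (ℕtoℚ-count (p ∘ suc)) (sym (+-identityˡ _))

pointMass : Fin m → ℚ → Fin m → ℚ
pointMass j a i = if j == i then a else 0ℚ

pointMass-nonneg : (j : Fin m) {a : ℚ} → 0ℚ ≤ a → ∀ i → 0ℚ ≤ pointMass j a i
pointMass-nonneg j 0≤a i with j ≟ i
... | yes refl = 0≤a
... | no  _    = ≤-refl

sumOver-pointMass : (p : Fin m → Bool) (j : Fin m) (a : ℚ) → sumOver p (pointMass j a) ≡ (if p j then a else 0ℚ)
sumOver-pointMass p j a = trans (sum-cong-≗ pointwise) (sum-sift j (λ i → if p i then a else 0ℚ))
  where
  pointwise : ∀ i → restrict p (pointMass j a) i ≡ (if j == i then (if p i then a else 0ℚ) else 0ℚ)
  pointwise i with p i | j == i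
  ... | true  | _     = refl
  ... | false | true  = refl
  ... | false | false = refl

deplete : Fin m → ℚ → (Fin m → ℚ) → Fin m → ℚ
deplete j δ f i = f i - pointMass j δ i

module _ {j : Fin m} {δ : ℚ} {f : Fin m → ℚ} where

  deplete-exhausts : δ ≡ f j → deplete j δ f j ≡ 0ℚ
  deplete-exhausts δ≡fⱼ = begin
    f j - pointMass j δ j   ≡⟨ cong (λ b → f j - (if b then δ else 0ℚ)) (==-refl j) ⟩
    f j - δ                 ≡⟨ cong (_-_ (f j)) δ≡fⱼ ⟩
    f j - f j               ≡⟨ +-inverseʳ (f j) ⟩
    0ℚ                      ∎
    where open ≡-Reasoning

  deplete-≤ : 0ℚ ≤ δ → ∀ i → deplete j δ f i ≤ f i
  deplete-≤ 0≤δ i = 0≤y⇒x-y≤x (f i) (pointMass-nonneg j 0≤δ i)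

  deplete-nonneg : (∀ i → 0ℚ ≤ f i) → δ ≤ f j → ∀ i → 0ℚ ≤ deplete j δ f i
  deplete-nonneg 0≤f δ≤fⱼ i with j ≟ i
  ... | yes refl = x≤y⇒0≤y-x δ≤fⱼ
  ... | no  _    = subst (0ℚ ≤_) (sym (+-identityʳ (f i))) (0≤f i)

  deplete+pointMass : ∀ i → deplete j δ f i + pointMass j δ i ≡ f i
  deplete+pointMass i = x-y+y≡x (f i) (pointMass j δ i)

  sumOver-deplete : (p : Fin m → Bool) → sumOver p (deplete j δ f) ≡ sumOver p f - (if p j then δ else 0ℚ)
  sumOver-deplete p = trans (sumOver-- p f (pointMass j δ)) (cong (_-_ (sumOver p f)) (sumOver-pointMass p j δ))

npos : (Fin m → ℚ) → ℕ
npos f = count (positive? ∘ f)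

npos-mono : {f g : Fin m → ℚ} → (∀ i → f i ≤ g i) → npos f ≤ℕ npos g
npos-mono {g = g} f≤g = count-mono (λ i fᵢ>0 → dec-true (0ℚ <? g i) (<-≤-trans (positive?-sound fᵢ>0) (f≤g i)))

npos-< : {f g : Fin m → ℚ} → (∀ i → f i ≤ g i) → (j : Fin m) → f j ≤ 0ℚ → 0ℚ < g j → npos f <ℕ npos g
npos-< {f = f} {g} f≤g j fⱼ≤0 gⱼ>0 =
  count-< (λ i fᵢ>0 → dec-true (0ℚ <? g i) (<-≤-trans (positive?-sound fᵢ>0) (f≤g i))) j
          (dec-false (0ℚ <? f j) (λ fⱼ>0 → <-irrefl refl (<-≤-trans fⱼ>0 fⱼ≤0))) (dec-true (0ℚ <? g j) gⱼ>0)

listSum : {A : Set} → (A → ℚ) → List A → ℚ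
listSum h []       = 0ℚ
listSum h (x ∷ xs) = h x + listSum h xs

module _ {A : Set} (h : A → ℚ) where

  sum-lookup : (xs : List A) → sum (h ∘ lookup xs) ≡ listSum h xs
  sum-lookup []       = refl
  sum-lookup (x ∷ xs) = cong (h x +_) (sum-lookup xs)

  listSum-++ : (xs ys : List A) → listSum h (xs ++ ys) ≡ listSum h xs + listSum h ys
  listSum-++ []       ys = sym (+-identityˡ (listSum h ys))
  listSum-++ (x ∷ xs) ys =
    trans (cong (h x +_) (listSum-++ xs ys)) (sym (+-assoc (h x) (listSum h xs) (listSum h ys)))

  listSum-concatMap : {B : Set} (f : B → List A) (g : Fin m → B) →
                      listSum h (concatMap f (tabulate g)) ≡ sum (λ i → listSum h (f (g i)))
  listSum-concatMap {zero}  f g = refl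
  listSum-concatMap {suc m} f g =
    trans (listSum-++ (f (g zero)) (concatMap f (tabulate (g ∘ suc))))
          (cong (listSum h (f (g zero)) +_) (listSum-concatMap f (g ∘ suc)))

  listSum-if : ∀ b x → listSum h (if b then x ∷ [] else []) ≡ (if b then h x else 0ℚ)
  listSum-if true  x = +-identityʳ (h x)
  listSum-if false x = refl

All-concatMap : {A B : Set} {P : A → Set} (f : B → List A) (g : Fin m → B) →
                (∀ i → All P (f (g i))) → All P (concatMap f (tabulate g))
All-concatMap f g all = concat⁺ (map⁺ (tabulate⁺ all))

All-if : {A : Set} {P : A → Set} (b : Bool) {x : A} → (b ≡ true → P x) → All P (if b then x ∷ [] else [])
All-if true  Px = Px refl ∷ []
All-if false Px = []

-- Without function extensionality, subsets given as functions are only listed up to ≗; hence the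
-- congruence hypotheses on the families and objective functions below.
subsets : ∀ k → List (Fin k → Bool)
subsets zero    = (λ ()) ∷ []
subsets (suc k) = map (true ◂_) (subsets k) ++ map (false ◂_) (subsets k)

subsets-complete : (B : Fin k → Bool) → ∃[ B′ ] B′ ∈ subsets k × B ≗ B′
subsets-complete {zero}  B = (λ ()) , here refl , λ ()
subsets-complete {suc k} B with subsets-complete (B ∘ suc) | B zero in B₀
... | B′ , B′∈ , B≗B′ | true  =
  true ◂ B′ , ∈-++⁺ˡ (∈-map⁺ (true ◂_) B′∈) , λ { zero → B₀ ; (suc i) → B≗B′ i }
... | B′ , B′∈ , B≗B′ | false =
  false ◂ B′ , ∈-++⁺ʳ (map (true ◂_) (subsets k)) (∈-map⁺ (false ◂_) B′∈) ,
  λ { zero → B₀ ; (suc i) → B≗B′ i }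

module Family {P : Pred (Fin k → Bool) 0ℓ} (P? : Decidable P) (P-resp : ∀ {B B′} → B ≗ B′ → P B → P B′) where

  members : List (Fin k → Bool)
  members = filter P? (subsets k)

  member-sound : ∀ {B} → B ∈ members → P B
  member-sound = proj₂ ∘ ∈-filter⁻ P? {xs = subsets k}

  member-complete : ∀ {B} → P B → ∃[ B′ ] B′ ∈ members × B ≗ B′
  member-complete {B} PB with subsets-complete B
  ... | B′ , B′∈ , B≗B′ = B′ , ∈-filter⁺ P? B′∈ (P-resp B≗B′ PB) , B≗B′

  module _ (F : (Fin k → Bool) → ℚ) (F-cong : ∀ {B B′} → B ≗ B′ → F B ≡ F B′) where

    bound-from-members : ∀ {v} → All (λ B → v ≤ F B) members → ∀ B → P B → v ≤ F B
    bound-from-members v≤ B PB with member-complete PB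
    ... | B′ , B′∈ , B≗B′ = subst (_ ≤_) (sym (F-cong B≗B′)) (All.lookup v≤ B′∈)

    minimum : (∀ B → ¬ P B) ⊎ ∃[ B ] P B × ∀ B′ → P B′ → F B ≤ F B′
    minimum with members in members≡ | all-filter P? (subsets k)
    ... | []      | _         =
      inj₁ λ B PB → let _ , B′∈ , _ = member-complete PB in case subst (_ ∈_) members≡ B′∈ of λ ()
    ... | B₀ ∷ Bs | PB₀ ∷ PBs =
      inj₂ (argmin F B₀ Bs , argmin-all F PB₀ PBs , bound-from-members (subst (All _) (sym members≡)
        (f[argmin]≤f[⊤] {f = F} B₀ Bs ∷ f[argmin]≤f[xs] {f = F} B₀ Bs)))

-- Hall's theorem for fractional transportation problems

module Transportation {n k : ℕ} (E : Fin n → Fin k → Bool) where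

  N : (Fin k → Bool) → Fin n → Bool
  N B u = anyFin (λ z → B z ∧ E u z)

  N-cong : ∀ {B B′} → B ≗ B′ → N B ≗ N B′
  N-cong B≗B′ u = anyFin-cong (λ z → cong (_∧ E u z) (B≗B′ z))

  N-intro : ∀ {B u z} → B z ≡ true → E u z ≡ true → N B u ≡ true
  N-intro {B} {u} {z} Bz Euz = anyFin-intro (λ z → B z ∧ E u z) z (∧-intro Bz Euz)

  N-witness : ∀ {B u} → N B u ≡ true → ∃[ z ] B z ≡ true × E u z ≡ true
  N-witness NBu = let z , BEz = anyFin-witness _ NBu in z , ∧-elimˡ BEz , ∧-elimʳ BEz

  N-mono : ∀ {B B′} → B ⊆ B′ → N B ⊆ N B′
  N-mono B⊆B′ u NBu = let z , Bz , Euz = N-witness NBu in N-intro (B⊆B′ z Bz) Euz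

  N-∧ : ∀ {B B′} → N (λ z → B z ∧ B′ z) ⊆ (λ u → N B u ∧ N B′ u)
  N-∧ u NUu = ∧-intro (N-mono (λ _ → ∧-elimˡ) u NUu) (N-mono (λ _ → ∧-elimʳ) u NUu)

  N-∨ : ∀ {B B′} → N (λ z → B z ∨ B′ z) ⊆ (λ u → N B u ∨ N B′ u)
  N-∨ {B} {B′} u NUu with N-witness NUu
  ... | z , Uz , Euz with B z in Bz
  ...   | true  rewrite N-intro {B} Bz Euz = refl
  ...   | false rewrite N-intro {B′} Uz Euz = ∨-zeroʳ (N B u)

  HallCondition : (Fin n → ℚ) → (Fin k → ℚ) → Set
  HallCondition c b = ∀ B → sumOver B b ≤ sumOver (N B) c

  slack : (Fin n → ℚ) → (Fin k → ℚ) → (Fin k → Bool) → ℚ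
  slack c b B = sumOver (N B) c - sumOver B b

  record Transport (c : Fin n → ℚ) (b : Fin k → ℚ) : Set where
    field
      flow          : Fin n → Fin k → ℚ
      nonneg        : ∀ u z → 0ℚ ≤ flow u z
      supported     : ∀ u z → E u z ≡ false → flow u z ≡ 0ℚ
      within-supply : ∀ u → sum (flow u) ≤ c u
      meets-demand  : ∀ z → sum (λ u → flow u z) ≡ b z
  open Transport

  Transport-zero : ∀ {c b} → (∀ u → 0ℚ ≤ c u) → (∀ z → b z ≡ 0ℚ) → Transport c b
  Transport-zero 0≤c b≡0 = record
    { flow          = λ _ _ → 0ℚ
    ; nonneg        = λ _ _ → ≤-refl
    ; supported     = λ _ _ _ → refl
    ; within-supply = λ u → subst (_≤ _) (sym (sum-zero {k} λ _ → refl)) (0≤c u)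
    ; meets-demand  = λ z → trans (sum-zero {n} λ _ → refl) (sym (b≡0 z))
    }

  Transport-+ : ∀ {c₁ b₁ c₂ b₂ c b} → Transport c₁ b₁ → Transport c₂ b₂ →
                (∀ u → c₁ u + c₂ u ≤ c u) → (∀ z → b₁ z + b₂ z ≡ b z) → Transport c b
  Transport-+ t₁ t₂ c₁+c₂≤c b₁+b₂≡b = record
    { flow          = λ u z → flow t₁ u z + flow t₂ u z
    ; nonneg        = λ u z → +-mono-≤ (nonneg t₁ u z) (nonneg t₂ u z)
    ; supported     = λ u z ¬Euz → cong₂ _+_ (supported t₁ u z ¬Euz) (supported t₂ u z ¬Euz)
    ; within-supply = λ u → subst (_≤ _) (sym (∑-distrib-+ (flow t₁ u) (flow t₂ u)))
                              (≤-trans (+-mono-≤ (within-supply t₁ u) (within-supply t₂ u)) (c₁+c₂≤c u))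
    ; meets-demand  = λ z → trans (∑-distrib-+ (λ u → flow t₁ u z) (λ u → flow t₂ u z))
                              (trans (cong₂ _+_ (meets-demand t₁ z) (meets-demand t₂ z)) (b₁+b₂≡b z))
    }

  Transport-edge : ∀ {u₀ z₀ δ} → E u₀ z₀ ≡ true → 0ℚ ≤ δ → Transport (pointMass u₀ δ) (pointMass z₀ δ)
  Transport-edge {u₀} {z₀} {δ} Eu₀z₀ 0≤δ = record
    { flow          = along
    ; nonneg        = λ u → pointMass-nonneg z₀ (pointMass-nonneg u₀ 0≤δ u)
    ; supported     = off-edge
    ; within-supply = λ u → ≤-reflexive (sum-sift z₀ (λ _ → pointMass u₀ δ u))
    ; meets-demand  = column
    }
    where
    along : Fin n → Fin k → ℚ
    along u = pointMass z₀ (pointMass u₀ δ u)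

    off-edge : ∀ u z → E u z ≡ false → along u z ≡ 0ℚ
    off-edge u z ¬Euz with z₀ ≟ z | u₀ ≟ u
    ... | yes refl | yes refl = ⊥-elim (true≢false (trans (sym Eu₀z₀) ¬Euz))
    ... | yes refl | no  _    = refl
    ... | no  _    | _        = refl

    column : ∀ z → sum (λ u → along u z) ≡ pointMass z₀ δ z
    column z with z₀ ≟ z
    ... | yes refl = sum-sift u₀ (λ _ → δ)
    ... | no  _    = sum-zero {n} (λ _ → refl)

  record Admissible (c : Fin n → ℚ) (b : Fin k → ℚ) : Set where
    field
      supply-nonneg : ∀ u → 0ℚ ≤ c u
      demand-nonneg : ∀ z → 0ℚ ≤ b z
      hall          : HallCondition c b

  module _ {c : Fin n → ℚ} {b : Fin k → ℚ} {u₀ : Fin n} {z₀ : Fin k} {δ : ℚ} (Eu₀z₀ : E u₀ z₀ ≡ true) where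

    push-transport : 0ℚ ≤ δ → Transport (deplete u₀ δ c) (deplete z₀ δ b) → Transport c b
    push-transport 0≤δ t = Transport-+ t (Transport-edge Eu₀z₀ 0≤δ)
      (≤-reflexive ∘ deplete+pointMass {j = u₀} {δ} {c}) (deplete+pointMass {j = z₀} {δ} {b})

    push-hall : HallCondition c b → (∀ B → B z₀ ≡ false → N B u₀ ≡ true → δ ≤ slack c b B) →
                HallCondition (deplete u₀ δ c) (deplete z₀ δ b)
    push-hall hall δ≤slack B = subst₂ _≤_ (sym (sumOver-deplete B)) (sym (sumOver-deplete (N B))) cases
      where
      cases : sumOver B b - (if B z₀ then δ else 0ℚ) ≤ sumOver (N B) c - (if N B u₀ then δ else 0ℚ)
      cases with B z₀ in Bz₀ | N B u₀ in NBu₀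
      ... | true  | true  = +-monoˡ-≤ (- δ) (hall B)
      ... | true  | false = ⊥-elim (true≢false (trans (sym (N-intro Bz₀ Eu₀z₀)) NBu₀))
      ... | false | true  = subst (_≤ sumOver (N B) c - δ) (sym (+-identityʳ (sumOver B b)))
                                 (δ≤y-x⇒x≤y-δ {sumOver B b} {sumOver (N B) c} (δ≤slack B Bz₀ NBu₀))
      ... | false | false = +-monoˡ-≤ (- 0ℚ) (hall B)

    push-tight : ∀ {B} → B z₀ ≡ false → N B u₀ ≡ true → δ ≡ slack c b B →
                 sumOver B (deplete z₀ δ b) ≡ sumOver (N B) (deplete u₀ δ c)
    push-tight {B} Bz₀ NBu₀ δ≡slack = begin
      sumOver B (deplete z₀ δ b)                   ≡⟨ sumOver-deplete B ⟩
      sumOver B b - (if B z₀ then δ else 0ℚ)       ≡⟨ cong (λ t → sumOver B b - (if t then δ else 0ℚ)) Bz₀ ⟩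
      sumOver B b - 0ℚ                             ≡⟨ +-identityʳ (sumOver B b) ⟩
      sumOver B b                                  ≡⟨ sym (x-[x-y]≡y (sumOver (N B) c) (sumOver B b)) ⟩
      sumOver (N B) c - slack c b B                ≡⟨ cong (_-_ (sumOver (N B) c)) (sym δ≡slack) ⟩
      sumOver (N B) c - δ                          ≡⟨ cong (λ t → sumOver (N B) c - (if t then δ else 0ℚ)) (sym NBu₀) ⟩
      sumOver (N B) c - (if N B u₀ then δ else 0ℚ) ≡⟨ sym (sumOver-deplete (N B)) ⟩
      sumOver (N B) (deplete u₀ δ c)               ∎
      where open ≡-Reasoning

  module _ {c : Fin n → ℚ} {b : Fin k → ℚ} (adm : Admissible c b) (B : Fin k → Bool) where
    open Admissible adm

    split-inside : Admissible (restrict (N B) c) (restrict B b)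
    split-inside = record
      { supply-nonneg = restrict-nonneg {p = N B} supply-nonneg
      ; demand-nonneg = restrict-nonneg {p = B} demand-nonneg
      ; hall          = λ B′ → begin
          sumOver B′ (restrict B b)           ≡⟨ sumOver-restrict B′ B b ⟩
          sumOver (λ z → B′ z ∧ B z) b        ≤⟨ hall (λ z → B′ z ∧ B z) ⟩
          sumOver (N (λ z → B′ z ∧ B z)) c    ≤⟨ sumOver-mono supply-nonneg N-∧ ⟩
          sumOver (λ u → N B′ u ∧ N B u) c    ≡⟨ sym (sumOver-restrict (N B′) (N B) c) ⟩
          sumOver (N B′) (restrict (N B) c)   ∎
      }
      where open ≤-Reasoning

    split-outside : sumOver B b ≡ sumOver (N B) c → Admissible (restrict (not ∘ N B) c) (restrict (not ∘ B) b)
    split-outside tight = record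
      { supply-nonneg = restrict-nonneg {p = not ∘ N B} supply-nonneg
      ; demand-nonneg = restrict-nonneg {p = not ∘ B} demand-nonneg
      ; hall          = λ B′ → begin
          sumOver B′ (restrict (not ∘ B) b)           ≡⟨ sumOver-restrict B′ (not ∘ B) b ⟩
          sumOver (λ z → B′ z ∧ not (B z)) b          ≤⟨ +-cancelʳ-≤ (sumOver B b) (with-B B′) ⟩
          sumOver (λ u → N B′ u ∧ not (N B u)) c      ≡⟨ sym (sumOver-restrict (N B′) (not ∘ N B) c) ⟩
          sumOver (N B′) (restrict (not ∘ N B) c)     ∎
      }
      where
      open ≤-Reasoning
      with-B : ∀ B′ → sumOver (λ z → B′ z ∧ not (B z)) b + sumOver B b
                      ≤ sumOver (λ u → N B′ u ∧ not (N B u)) c + sumOver B b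
      with-B B′ = begin
        sumOver (λ z → B′ z ∧ not (B z)) b + sumOver B b         ≡⟨ sym (sumOver-∨ B′ B b) ⟩
        sumOver (λ z → B′ z ∨ B z) b                             ≤⟨ hall (λ z → B′ z ∨ B z) ⟩
        sumOver (N (λ z → B′ z ∨ B z)) c                         ≤⟨ sumOver-mono supply-nonneg N-∨ ⟩
        sumOver (λ u → N B′ u ∨ N B u) c                         ≡⟨ sumOver-∨ (N B′) (N B) c ⟩
        sumOver (λ u → N B′ u ∧ not (N B u)) c + sumOver (N B) c
          ≡⟨ cong (sumOver (λ u → N B′ u ∧ not (N B u)) c +_) (sym tight) ⟩
        sumOver (λ u → N B′ u ∧ not (N B u)) c + sumOver B b     ∎

    split-transport : Transport (restrict (N B) c) (restrict B b) →
                      Transport (restrict (not ∘ N B) c) (restrict (not ∘ B) b) → Transport c b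
    split-transport inside outside =
      Transport-+ inside outside (≤-reflexive ∘ restrict-split (N B) c) (restrict-split B b)

  record Dominated (c′ : Fin n → ℚ) (b′ : Fin k → ℚ) (c : Fin n → ℚ) (b : Fin k → ℚ) : Set where
    field
      supply-≤ : ∀ u → c′ u ≤ c u
      demand-≤ : ∀ z → b′ z ≤ b z
      exhausts : (∃[ u ] c′ u ≤ 0ℚ × 0ℚ < c u) ⊎ (∃[ z ] b′ z ≤ 0ℚ × 0ℚ < b z)

  measure : (Fin n → ℚ) → (Fin k → ℚ) → ℕ
  measure c b = npos c +ℕ npos b

  measure-< : ∀ {c′ b′ c b} → Dominated c′ b′ c b → measure c′ b′ <ℕ measure c b
  measure-< record { supply-≤ = c′≤c ; demand-≤ = b′≤b ; exhausts = inj₁ (u , c′ᵤ≤0 , cᵤ>0) } =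
    ℕ.+-mono-<-≤ (npos-< c′≤c u c′ᵤ≤0 cᵤ>0) (npos-mono b′≤b)
  measure-< record { supply-≤ = c′≤c ; demand-≤ = b′≤b ; exhausts = inj₂ (z , b′₂≤0 , b₂>0) } =
    ℕ.+-mono-≤-< (npos-mono c′≤c) (npos-< b′≤b z b′₂≤0 b₂>0)

  -- One round: push along an edge u₀z₀ into a sink z₀ with positive demand as much as Hall's condition
  -- allows. The amount δ is limited by the demand of z₀, by the supply of u₀, or by a set B avoiding z₀
  -- whose slack it uses up; then B becomes tight and the problem splits along B.
  module Round {c : Fin n → ℚ} {b : Fin k → ℚ} (adm : Admissible c b) {z₀ : Fin k} (bz₀>0 : 0ℚ < b z₀) where
    open Admissible adm

    supplier : ∃[ u₀ ] E u₀ z₀ ≡ true × 0ℚ < c u₀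
    supplier =
      let u₀ , N[z₀]u₀ , cu₀>0 = sumOver-pos-witness {p = N (z₀ ==_)} {f = c}
                                   (<-≤-trans bz₀>0 (subst (_≤ _) (sum-sift z₀ b) (hall (z₀ ==_))))
          z , z₀≡z , Eu₀z = N-witness N[z₀]u₀
      in u₀ , subst (λ z → E u₀ z ≡ true) (sym (==⇒≡ z₀≡z)) Eu₀z , cu₀>0

    u₀ : Fin n
    u₀ = proj₁ supplier

    Eu₀z₀ : E u₀ z₀ ≡ true
    Eu₀z₀ = proj₁ (proj₂ supplier)

    cu₀>0 : 0ℚ < c u₀
    cu₀>0 = proj₂ (proj₂ supplier)

    Blocking : Pred (Fin k → Bool) 0ℓ
    Blocking B = B z₀ ≡ false × N B u₀ ≡ true

    blocking? : Decidable Blocking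
    blocking? B = (B z₀ Bool.≟ false) ×-dec (N B u₀ Bool.≟ true)

    blocking-resp : ∀ {B B′} → B ≗ B′ → Blocking B → Blocking B′
    blocking-resp B≗B′ (Bz₀ , NBu₀) = trans (sym (B≗B′ z₀)) Bz₀ , trans (sym (N-cong B≗B′ u₀)) NBu₀

    open Family blocking? blocking-resp using (members; member-sound; bound-from-members)

    slack-cong : ∀ {B B′} → B ≗ B′ → slack c b B ≡ slack c b B′
    slack-cong B≗B′ = cong₂ _-_ (sumOver-cong (N-cong B≗B′) (λ _ → refl)) (sumOver-cong B≗B′ (λ _ → refl))

    δ : ℚ
    δ = min (b z₀) (c u₀ ∷ map (slack c b) members)

    δ≤demand : δ ≤ b z₀
    δ≤demand = min≤⊤ (b z₀) (c u₀ ∷ map (slack c b) members)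

    δ≤supply : δ ≤ c u₀
    δ≤supply = All.head (min≤xs (b z₀) (c u₀ ∷ map (slack c b) members))

    δ≤slack : ∀ B → Blocking B → δ ≤ slack c b B
    δ≤slack = bound-from-members (slack c b) slack-cong
                (map⁻ (All.tail (min≤xs (b z₀) (c u₀ ∷ map (slack c b) members))))

    0≤δ : 0ℚ ≤ δ
    0≤δ = v≤min⁺ {xs = c u₀ ∷ map (slack c b) members} (demand-nonneg z₀)
            (supply-nonneg u₀ ∷ map⁺ (All.tabulate (λ {B} _ → x≤y⇒0≤y-x (hall B))))

    Bottleneck : Set
    Bottleneck = δ ≡ b z₀ ⊎ δ ≡ c u₀ ⊎ ∃[ B ] Blocking B × δ ≡ slack c b B

    bottleneck : Bottleneck
    bottleneck = classify (argmin-sel id (b z₀) (c u₀ ∷ map (slack c b) members))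
      where
      classify : δ ≡ b z₀ ⊎ δ ∈ c u₀ ∷ map (slack c b) members → Bottleneck
      classify (inj₁ δ≡demand)        = inj₁ δ≡demand
      classify (inj₂ (here δ≡supply)) = inj₂ (inj₁ δ≡supply)
      classify (inj₂ (there δ∈))      =
        let B , B∈ , δ≡slack = ∈-map⁻ (slack c b) δ∈ in inj₂ (inj₂ (B , member-sound B∈ , δ≡slack))

    c′ : Fin n → ℚ
    c′ = deplete u₀ δ c

    b′ : Fin k → ℚ
    b′ = deplete z₀ δ b

    pushed : Admissible c′ b′
    pushed = record
      { supply-nonneg = deplete-nonneg {j = u₀} {δ} {c} supply-nonneg δ≤supply
      ; demand-nonneg = deplete-nonneg {j = z₀} {δ} {b} demand-nonneg δ≤demand
      ; hall          = push-hall Eu₀z₀ hall (λ B Bz₀ NBu₀ → δ≤slack B (Bz₀ , NBu₀))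
      }

    dominated : ∀ {c″ b″} → (∀ u → c″ u ≤ c′ u) → (∀ z → b″ z ≤ b′ z) →
                (∃[ u ] c″ u ≤ 0ℚ × 0ℚ < c u) ⊎ (∃[ z ] b″ z ≤ 0ℚ × 0ℚ < b z) → Dominated c″ b″ c b
    dominated c″≤c′ b″≤b′ exhausts = record
      { supply-≤ = λ u → ≤-trans (c″≤c′ u) (deplete-≤ {j = u₀} {δ} {c} 0≤δ u)
      ; demand-≤ = λ z → ≤-trans (b″≤b′ z) (deplete-≤ {j = z₀} {δ} {b} 0≤δ z)
      ; exhausts = exhausts
      }

    step : (∀ {c″ b″} → Admissible c″ b″ → Dominated c″ b″ c b → Transport c″ b″) → Transport c b
    step recurse = push-transport Eu₀z₀ 0≤δ (by-bottleneck bottleneck)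
      where
      open Admissible pushed using () renaming (supply-nonneg to 0≤c′; demand-nonneg to 0≤b′)

      by-bottleneck : Bottleneck → Transport c′ b′
      by-bottleneck (inj₁ δ≡demand) = recurse pushed (dominated (λ _ → ≤-refl) (λ _ → ≤-refl)
        (inj₂ (z₀ , ≤-reflexive (deplete-exhausts {j = z₀} {δ} {b} δ≡demand) , bz₀>0)))
      by-bottleneck (inj₂ (inj₁ δ≡supply)) = recurse pushed (dominated (λ _ → ≤-refl) (λ _ → ≤-refl)
        (inj₁ (u₀ , ≤-reflexive (deplete-exhausts {j = u₀} {δ} {c} δ≡supply) , cu₀>0)))
      by-bottleneck (inj₂ (inj₂ (B , (Bz₀ , NBu₀) , δ≡slack))) = split-transport pushed B
        (recurse (split-inside pushed B)
          (dominated (restrict-≤ {p = N B} 0≤c′) (restrict-≤ {p = B} 0≤b′)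
                     (inj₂ (z₀ , ≤-reflexive (restrict-off B b′ Bz₀) , bz₀>0))))
        (recurse (split-outside pushed B (push-tight Eu₀z₀ Bz₀ NBu₀ δ≡slack))
          (dominated (restrict-≤ {p = not ∘ N B} 0≤c′) (restrict-≤ {p = not ∘ B} 0≤b′)
                     (inj₁ (u₀ , ≤-reflexive (restrict-off (not ∘ N B) c′ (cong not NBu₀)) , cu₀>0))))

  transport : ∀ {c b} → Admissible c b → Transport c b
  transport adm = go adm (<-wellFounded _)
    where
    go : ∀ {c b} → Admissible c b → Acc _<ℕ_ (measure c b) → Transport c b
    go {c} {b} adm (acc smaller) with Fin.any? (λ z → 0ℚ <? b z)
    ... | yes (z₀ , bz₀>0) = Round.step adm bz₀>0 (λ adm′ dominated → go adm′ (smaller (measure-< dominated)))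
    ... | no  no-demand    =
      Transport-zero supply-nonneg (λ z → ≤-antisym (≮⇒≥ (λ bz>0 → no-demand (z , bz>0))) (demand-nonneg z))
      where open Admissible adm

-- An infinite capacity is read as the junk value 0; cut-condition only reads capacities of arcs that are
-- required to be bounded.
finite : Maybe ℚ → ℚ
finite (just c) = c
finite nothing  = 0ℚ

enters leaves : ∀ {V} → (Fin V → Bool) → Arc V → Bool
enters X α = X (dst α) ∧ not (X (src α))
leaves X α = X (src α) ∧ not (X (dst α))

crossing-bound : ∀ {V} (X : Fin V → Bool) (α : Arc V) {x : ℚ} → lower α ≤ x → UpperOK (upper α) x →
                 (enters X α ≡ true → ∃[ c ] upper α ≡ just c) →
                 (ind (X (dst α)) - ind (X (src α))) * x
                   ≤ (if enters X α then finite (upper α) else 0ℚ) - (if leaves X α then lower α else 0ℚ)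
crossing-bound X α {x} lower≤x ≤upper bounded-entry with X (dst α) | X (src α)
... | true  | true  = ≤-reflexive (*-zeroˡ x)
... | false | false = ≤-reflexive (*-zeroˡ x)
... | false | true  = subst₂ _≤_ (neg-distribˡ-* 1ℚ x) (sym (+-identityˡ (- lower α)))
                        (neg-antimono-≤ (subst (lower α ≤_) (sym (*-identityˡ x)) lower≤x))
... | true  | false with upper α | bounded-entry refl
...   | just c | _ = subst₂ _≤_ (sym (*-identityˡ x)) (sym (+-identityʳ c)) ≤upper

module _ {V : ℕ} (net : Network V) (f : Fin (length net) → ℚ) where

  private
    α : Fin (length net) → Arc V
    α = lookup net

  potential-balance : (∀ v → inflow net f v ≡ outflow net f v) → (g : Fin V → ℚ) →
                      sum (λ e → (g (dst (α e)) - g (src (α e))) * f e) ≡ 0ℚ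
  potential-balance conserved g = begin
    sum (λ e → (g (dst (α e)) - g (src (α e))) * f e)
      ≡⟨ sum-cong-≗ (λ e → [x-y]*z≡x*z-y*z (g (dst (α e))) (g (src (α e))) (f e)) ⟩
    sum (λ e → g (dst (α e)) * f e - g (src (α e)) * f e)
      ≡⟨ ∑-distrib-- (λ e → g (dst (α e)) * f e) (λ e → g (src (α e)) * f e) ⟩
    sum (λ e → g (dst (α e)) * f e) - sum (λ e → g (src (α e)) * f e)
      ≡⟨ cong₂ _-_ (sym (sum-regroup (dst ∘ α) g f)) (sym (sum-regroup (src ∘ α) g f)) ⟩
    sum (λ v → g v * into v) - sum (λ v → g v * out-of v)
      ≡⟨ cong (_- sum (λ v → g v * out-of v)) (sum-cong-≗ (λ v → cong (g v *_) (balanced v))) ⟩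
    sum (λ v → g v * out-of v) - sum (λ v → g v * out-of v)
      ≡⟨ +-inverseʳ (sum (λ v → g v * out-of v)) ⟩
    0ℚ ∎
    where
    open ≡-Reasoning
    into out-of : Fin V → ℚ
    into   v = sum (λ e → if dst (α e) == v then f e else 0ℚ)
    out-of v = sum (λ e → if src (α e) == v then f e else 0ℚ)
    balanced : ∀ v → into v ≡ out-of v
    balanced v = trans (sym (sumℚ≡sum (λ e → if dst (α e) == v then f e else 0ℚ)))
                       (trans (conserved v) (sumℚ≡sum (λ e → if src (α e) == v then f e else 0ℚ)))

  cut-condition : IsCirculation net f → (X : Fin V → Bool) →
                  (∀ e → enters X (α e) ≡ true → ∃[ c ] upper (α e) ≡ just c) →
                  sumOver (leaves X ∘ α) (lower ∘ α) ≤ sumOver (enters X ∘ α) (finite ∘ upper ∘ α)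
  cut-condition (within-bounds , conserved) X bounded-entries = 0≤y-x⇒x≤y (begin
    0ℚ                                                         ≡⟨ sym (potential-balance conserved (ind ∘ X)) ⟩
    sum (λ e → (ind (X (dst (α e))) - ind (X (src (α e)))) * f e)  ≤⟨ sum-mono crossing ⟩
    sum (λ e → entering e - leaving e)                          ≡⟨ ∑-distrib-- entering leaving ⟩
    sum entering - sum leaving                                  ∎)
    where
    open ≤-Reasoning
    entering leaving : Fin (length net) → ℚ
    entering = restrict (enters X ∘ α) (finite ∘ upper ∘ α)
    leaving  = restrict (leaves X ∘ α) (lower ∘ α)
    crossing : ∀ e → (ind (X (dst (α e))) - ind (X (src (α e)))) * f e ≤ entering e - leaving e
    crossing e = crossing-bound X (α e) (proj₁ (within-bounds e)) (proj₂ (within-bounds e)) (bounded-entries e)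

module EGNetworkProperties {n k : ℕ} (G : Graph n) (d : Fin n → Bool) (cl : Fin n → Fin k) where
  open Decomp G d cl
  open EGNetwork G d cl

  Nodes : ℕ
  Nodes = suc (suc (n +ℕ k))

  E : Fin n → Fin k → Bool
  E u z = inA G d u ∧ adjComp u z

  supply : Fin n → ℚ
  supply u = ind (inA G d u)

  excess : ℚ → Fin k → ℚ
  excess lam z = (ℕtoℚ (size z) * lam - ℕtoℚ (size z)) + 1ℚ

  demand : ℚ → Fin k → ℚ
  demand lam z = 0ℚ ⊔ excess lam z

  arc-s-u : Fin n → Arc Nodes
  arc-s-u u = arc sN (vN u) 0ℚ (just 1ℚ)

  arc-u-z : Fin n → Fin k → Arc Nodes
  arc-u-z u z = arc (vN u) (zN z) 0ℚ nothing

  arc-z-t : ℚ → Fin k → Arc Nodes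
  arc-z-t lam z = arc (zN z) tN (demand lam z) nothing

  arc-t-s : Arc Nodes
  arc-t-s = arc tN sN 0ℚ nothing

  data NetworkArc (lam : ℚ) : Arc Nodes → Set where
    s-u : ∀ {u} → inA G d u ≡ true → NetworkArc lam (arc-s-u u)
    u-z : ∀ {u z} → E u z ≡ true → NetworkArc lam (arc-u-z u z)
    z-t : ∀ z → NetworkArc lam (arc-z-t lam z)
    t-s : NetworkArc lam arc-t-s

  network-arc : ∀ lam e → NetworkArc lam (lookup (network lam) e)
  network-arc lam e = All.lookup all-arcs (∈-lookup e)
    where
    all-arcs : All (NetworkArc lam) (network lam)
    all-arcs = ++⁺ (All-concatMap _ id (λ u → All-if (inA G d u) s-u))
              (++⁺ (All-concatMap _ id (λ u → All-concatMap _ id (λ z → All-if (E u z) u-z)))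
              (++⁺ (All-concatMap _ id (λ z → z-t z ∷ [])) (t-s ∷ [])))

  sum-network : ∀ lam (h : Arc Nodes → ℚ) → sum (h ∘ lookup (network lam)) ≡
                sumOver (inA G d) (h ∘ arc-s-u) + (sum (λ u → sumOver (E u) (h ∘ arc-u-z u))
                                                + (sum (h ∘ arc-z-t lam) + h arc-t-s))
  sum-network lam h = begin
    sum (h ∘ lookup (network lam))               ≡⟨ sum-lookup h (network lam) ⟩
    listSum h (L₁ ++ L₂ ++ L₃ ++ arc-t-s ∷ [])   ≡⟨ listSum-++ h L₁ _ ⟩
    listSum h L₁ + listSum h (L₂ ++ L₃ ++ arc-t-s ∷ [])
      ≡⟨ cong₂ _+_ sources (trans (listSum-++ h L₂ _) (cong₂ _+_ adjacencies
                  (trans (listSum-++ h L₃ (arc-t-s ∷ [])) (cong₂ _+_ sinks (+-identityʳ (h arc-t-s)))))) ⟩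
    sumOver (inA G d) (h ∘ arc-s-u) + (sum (λ u → sumOver (E u) (h ∘ arc-u-z u)) + (sum (h ∘ arc-z-t lam) + h arc-t-s)) ∎
    where
    open ≡-Reasoning
    from-u : Fin n → List (Arc Nodes)
    from-u u = if inA G d u then arc-s-u u ∷ [] else []
    from-uz : Fin n → Fin k → List (Arc Nodes)
    from-uz u z = if E u z then arc-u-z u z ∷ [] else []
    L₁ = concatMap from-u (allFin n)
    L₂ = concatMap (λ u → concatMap (from-uz u) (allFin k)) (allFin n)
    L₃ = concatMap (λ z → arc-z-t lam z ∷ []) (allFin k)
    sources : listSum h L₁ ≡ sumOver (inA G d) (h ∘ arc-s-u)
    sources = trans (listSum-concatMap h from-u id) (sum-cong-≗ (λ u → listSum-if h (inA G d u) (arc-s-u u)))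
    adjacencies : listSum h L₂ ≡ sum (λ u → sumOver (E u) (h ∘ arc-u-z u))
    adjacencies = trans (listSum-concatMap h (λ u → concatMap (from-uz u) (allFin k)) id) (sum-cong-≗ (λ u →
      trans (listSum-concatMap h (from-uz u) id) (sum-cong-≗ (λ z → listSum-if h (E u z) (arc-u-z u z)))))
    sinks : listSum h L₃ ≡ sum (h ∘ arc-z-t lam)
    sinks = trans (listSum-concatMap h (λ z → arc-z-t lam z ∷ []) id) (sum-cong-≗ (λ z → +-identityʳ (h (arc-z-t lam z))))

  data NodeKind : Set where
    source sink : NodeKind
    vertex      : Fin n → NodeKind
    pseudonode  : Fin k → NodeKind

  kind : Node → NodeKind
  kind zero          = source
  kind (suc zero)    = sink
  kind (suc (suc i)) = [ vertex , pseudonode ]′ (splitAt n i)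

  kind-vN : ∀ u → kind (vN u) ≡ vertex u
  kind-vN u = cong [ vertex , pseudonode ]′ (Fin.splitAt-↑ˡ n u k)

  kind-zN : ∀ z → kind (zN z) ≡ pseudonode z
  kind-zN z = cong [ vertex , pseudonode ]′ (Fin.splitAt-↑ʳ n k z)

  InN⁻ : (Fin k → Bool) → Fin n → Bool
  InN⁻ B u = inA G d u ∧ anyFin (λ z → B z ∧ adjComp u z)

  InN⁻-intro : ∀ {B u z} → E u z ≡ true → B z ≡ true → InN⁻ B u ≡ true
  InN⁻-intro {B} {u} {z} Euz Bz =
    ∧-intro (∧-elimˡ Euz) (anyFin-intro (λ z → B z ∧ adjComp u z) z (∧-intro Bz (∧-elimʳ Euz)))

  InN⁻-mono : ∀ {B B′} → B ⊆ B′ → InN⁻ B ⊆ InN⁻ B′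
  InN⁻-mono {B} {B′} B⊆B′ u u∈N⁻B =
    let z , Bz∧adj = anyFin-witness (λ z → B z ∧ adjComp u z) (∧-elimʳ u∈N⁻B)
        Euz = ∧-intro {inA G d u} (∧-elimˡ {inA G d u} u∈N⁻B) (∧-elimʳ {B z} Bz∧adj)
    in InN⁻-intro {B′} {u} {z} Euz (B⊆B′ z (∧-elimˡ Bz∧adj))

  N⁻-mono : ∀ {B B′} → B ⊆ B′ → ℕtoℚ (N⁻ B) ≤ ℕtoℚ (N⁻ B′)
  N⁻-mono {B} {B′} B⊆B′ = subst₂ _≤_ (sym (ℕtoℚ-count (InN⁻ B))) (sym (ℕtoℚ-count (InN⁻ B′)))
                                   (sumOver-mono (λ _ → nonNegative⁻¹ 1ℚ) (InN⁻-mono B⊆B′))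

  -- The cut N⁻(B) ∪ B: only arcs s → u with u ∈ N⁻(B) enter it, and only arcs z → t with z ∈ B leave it.
  cutSide : (Fin k → Bool) → NodeKind → Bool
  cutSide B (vertex u)     = InN⁻ B u
  cutSide B (pseudonode z) = B z
  cutSide B _              = false

  cut : (Fin k → Bool) → Node → Bool
  cut B = cutSide B ∘ kind

  cut-vN : ∀ B u → cut B (vN u) ≡ InN⁻ B u
  cut-vN B u = cong (cutSide B) (kind-vN u)

  cut-zN : ∀ B z → cut B (zN z) ≡ B z
  cut-zN B z = cong (cutSide B) (kind-zN z)

  adjacency-inside-cut : ∀ B {u z} → E u z ≡ true → enters (cut B) (arc-u-z u z) ≡ false
  adjacency-inside-cut B {u} {z} Euz rewrite cut-vN B u | cut-zN B z with B z in Bz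
  ... | false = refl
  ... | true  rewrite InN⁻-intro {B} Euz Bz = refl

  entry-bounded : ∀ {lam} B {β} → NetworkArc lam β → enters (cut B) β ≡ true → ∃[ c ] upper β ≡ just c
  entry-bounded B (s-u _)   _       = 1ℚ , refl
  entry-bounded B (u-z Euz) entersβ = ⊥-elim (true≢false (trans (sym entersβ) (adjacency-inside-cut B Euz)))
  entry-bounded B (z-t _)   ()
  entry-bounded B t-s       ()

  module _ (lam : ℚ) (B : Fin k → Bool) where

    private
      α : Fin (length (network lam)) → Arc Nodes
      α = lookup (network lam)

    leaving-cut : sumOver (leaves (cut B) ∘ α) (lower ∘ α) ≡ sumOver B (demand lam)
    leaving-cut = begin
      sumOver (leaves (cut B) ∘ α) (lower ∘ α)                       ≡⟨ sum-network lam h ⟩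
      sumOver (inA G d) (h ∘ arc-s-u) + (sum (λ u → sumOver (E u) (h ∘ arc-u-z u)) + (sum (h ∘ arc-z-t lam) + 0ℚ))
        ≡⟨ cong₂ _+_ (sumOver-zero (inA G d) (λ _ _ → refl))
                     (cong₂ _+_ (sum-zero {n} (λ u → sumOver-zero (E u) (λ z _ → if-zero (leaves (cut B) (arc-u-z u z)))))
                                (+-identityʳ (sum (h ∘ arc-z-t lam)))) ⟩
      0ℚ + (0ℚ + sum (h ∘ arc-z-t lam))                               ≡⟨ trans (+-identityˡ _) (+-identityˡ _) ⟩
      sum (h ∘ arc-z-t lam)                                           ≡⟨ sum-cong-≗ sinks ⟩
      sumOver B (demand lam)                                          ∎
      where
      open ≡-Reasoning
      h : Arc Nodes → ℚ
      h β = if leaves (cut B) β then lower β else 0ℚ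
      sinks : ∀ z → h (arc-z-t lam z) ≡ restrict B (demand lam) z
      sinks z = cong (λ b → if b then demand lam z else 0ℚ) (trans (cong (_∧ true) (cut-zN B z)) (∧-identityʳ (B z)))

    entering-cut : sumOver (enters (cut B) ∘ α) (finite ∘ upper ∘ α) ≡ ℕtoℚ (N⁻ B)
    entering-cut = begin
      sumOver (enters (cut B) ∘ α) (finite ∘ upper ∘ α)               ≡⟨ sum-network lam h ⟩
      sumOver (inA G d) (h ∘ arc-s-u) + (sum (λ u → sumOver (E u) (h ∘ arc-u-z u)) + (sum {k} (λ _ → 0ℚ) + 0ℚ))
        ≡⟨ cong₂ _+_ (sum-cong-≗ sources) (cong₂ _+_ (sum-zero {n} (λ u → sumOver-zero (E u) (adjacencies u)))
                                                      (trans (+-identityʳ (sum {k} (λ _ → 0ℚ))) (sum-replicate-zero k))) ⟩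
      sumOver (InN⁻ B) (λ _ → 1ℚ) + (0ℚ + 0ℚ)                         ≡⟨ +-identityʳ (sumOver (InN⁻ B) (λ _ → 1ℚ)) ⟩
      sumOver (InN⁻ B) (λ _ → 1ℚ)                                     ≡⟨ sym (ℕtoℚ-count (InN⁻ B)) ⟩
      ℕtoℚ (N⁻ B)                                                    ∎
      where
      open ≡-Reasoning
      h : Arc Nodes → ℚ
      h β = if enters (cut B) β then finite (upper β) else 0ℚ
      sources : ∀ u → restrict (inA G d) (h ∘ arc-s-u) u ≡ restrict (InN⁻ B) (λ _ → 1ℚ) u
      sources u rewrite cut-vN B u | ∧-identityʳ (InN⁻ B u) with inA G d u
      ... | true  = refl
      ... | false = refl
      adjacencies : ∀ u z → E u z ≡ true → h (arc-u-z u z) ≡ 0ℚ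
      adjacencies u z Euz rewrite adjacency-inside-cut B Euz = refl

  demand-bound : ∀ lam → Feasible (network lam) → ∀ B → sumOver B (demand lam) ≤ ℕtoℚ (N⁻ B)
  demand-bound lam (f , circulation) B = subst₂ _≤_ (leaving-cut lam B) (entering-cut lam B)
    (cut-condition (network lam) f circulation (cut B) (entry-bounded B ∘ network-arc lam))

  open Transportation E using (N; Transport; Admissible; transport)

  module FromTransport (lam : ℚ) (t : Transport supply (demand lam)) where
    open Transport t

    row : Fin n → ℚ
    row u = sum (flow u)

    total : ℚ
    total = sum row

    between : NodeKind → NodeKind → ℚ
    between source         (vertex u)     = row u
    between (vertex u)     (pseudonode z) = flow u z
    between (pseudonode z) sink           = demand lam z
    between sink           source         = total
    between _              _              = 0ℚ

    F : Arc Nodes → ℚ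
    F β = between (kind (src β)) (kind (dst β))

    F-s-u : ∀ u → F (arc-s-u u) ≡ row u
    F-s-u u = cong (between source) (kind-vN u)

    F-u-z : ∀ u z → F (arc-u-z u z) ≡ flow u z
    F-u-z u z = cong₂ between (kind-vN u) (kind-zN z)

    F-z-t : ∀ z → F (arc-z-t lam z) ≡ demand lam z
    F-z-t z = cong (λ κ → between κ sink) (kind-zN z)

    within-bounds : ∀ {β} → NetworkArc lam β → (lower β ≤ F β) × UpperOK (upper β) (F β)
    within-bounds (s-u {u} u∈A) =
      subst (0ℚ ≤_) (sym (F-s-u u)) (sum-nonneg (nonneg u)) ,
      subst (_≤ 1ℚ) (sym (F-s-u u)) (subst (λ b → row u ≤ ind b) u∈A (within-supply u))
    within-bounds (u-z {u} {z} _) = subst (0ℚ ≤_) (sym (F-u-z u z)) (nonneg u z) , tt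
    within-bounds (z-t z)         = ≤-reflexive (sym (F-z-t z)) , tt
    within-bounds t-s             = sum-nonneg (λ u → sum-nonneg (nonneg u)) , tt

    weighted : (Fin n → Fin k → ℚ) → ℚ
    weighted w = sum (λ u → sum (λ z → w u z * flow u z))

    weighted-rows : (w : Fin n → ℚ) → sumOver (inA G d) (λ u → w u * row u) ≡ weighted (λ u _ → w u)
    weighted-rows w = trans (sumOver-supported (inA G d) idle) (sum-cong-≗ (λ u → *-distribˡ-sum (w u) (flow u)))
      where
      idle : ∀ u → inA G d u ≡ false → w u * row u ≡ 0ℚ
      idle u u∉A = trans (cong (w u *_) (sum-zero (λ z → supported u z (cong (_∧ adjComp u z) u∉A)))) (*-zeroʳ (w u))

    weighted-edges : (w : Fin n → Fin k → ℚ) → sum (λ u → sumOver (E u) (λ z → w u z * flow u z)) ≡ weighted w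
    weighted-edges w = sum-cong-≗ (λ u → sumOver-supported (E u) (λ z ¬Euz →
                         trans (cong (w u z *_) (supported u z ¬Euz)) (*-zeroʳ (w u z))))

    weighted-columns : (w : Fin k → ℚ) → sum (λ z → w z * demand lam z) ≡ weighted (λ _ z → w z)
    weighted-columns w = begin
      sum (λ z → w z * demand lam z)           ≡⟨ sum-cong-≗ (λ z → cong (w z *_) (sym (meets-demand z))) ⟩
      sum (λ z → w z * sum (λ u → flow u z))   ≡⟨ sum-cong-≗ (λ z → *-distribˡ-sum (w z) (λ u → flow u z)) ⟩
      sum (λ z → sum (λ u → w z * flow u z))   ≡⟨ ∑-comm (λ z u → w z * flow u z) ⟩
      weighted (λ _ z → w z)                   ∎
      where open ≡-Reasoning

    weighted-total : (c : ℚ) → c * total ≡ weighted (λ _ _ → c)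
    weighted-total c = trans (*-distribˡ-sum c row) (sum-cong-≗ (λ u → *-distribˡ-sum c (flow u)))

    -- Every unit of flow runs around a cycle s → u → z → t → s: weighting each arc by a function φ of its
    -- head or of its tail, the total counts φ once at each of the four nodes of the cycle.
    into : (φ : Fin Nodes → ℚ) → sum (λ e → φ (dst (lookup (network lam) e)) * F (lookup (network lam) e)) ≡
           weighted (λ u _ → φ (vN u)) + (weighted (λ _ z → φ (zN z)) + (weighted (λ _ _ → φ tN) + weighted (λ _ _ → φ sN)))
    into φ = trans (sum-network lam (λ β → φ (dst β) * F β))
      (cong₂ _+_ (trans (sumOver-cong (λ _ → refl) (λ u → cong (φ (vN u) *_) (F-s-u u))) (weighted-rows (φ ∘ vN)))
      (cong₂ _+_ (trans (sum-cong-≗ (λ u → sumOver-cong (λ _ → refl) (λ z → cong (φ (zN z) *_) (F-u-z u z))))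
                        (weighted-edges (λ _ z → φ (zN z))))
      (cong₂ _+_ (trans (sum-cong-≗ (λ z → cong (φ tN *_) (F-z-t z))) (weighted-columns (λ _ → φ tN)))
                 (weighted-total (φ sN)))))

    out-of : (φ : Fin Nodes → ℚ) → sum (λ e → φ (src (lookup (network lam) e)) * F (lookup (network lam) e)) ≡
             weighted (λ _ _ → φ sN) + (weighted (λ u _ → φ (vN u)) + (weighted (λ _ z → φ (zN z)) + weighted (λ _ _ → φ tN)))
    out-of φ = trans (sum-network lam (λ β → φ (src β) * F β))
      (cong₂ _+_ (trans (sumOver-cong (λ _ → refl) (λ u → cong (φ sN *_) (F-s-u u))) (weighted-rows (λ _ → φ sN)))
      (cong₂ _+_ (trans (sum-cong-≗ (λ u → sumOver-cong (λ _ → refl) (λ z → cong (φ (vN u) *_) (F-u-z u z))))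
                        (weighted-edges (λ u _ → φ (vN u))))
      (cong₂ _+_ (trans (sum-cong-≗ (λ z → cong (φ (zN z) *_) (F-z-t z))) (weighted-columns (φ ∘ zN)))
                 (weighted-total (φ tN)))))

    conserved : ∀ v → inflow (network lam) (F ∘ lookup (network lam)) v ≡ outflow (network lam) (F ∘ lookup (network lam)) v
    conserved v = begin
      inflow (network lam) (F ∘ α) v                       ≡⟨ sumℚ≡sum (λ e → if dst (α e) == v then F (α e) else 0ℚ) ⟩
      sum (λ e → if dst (α e) == v then F (α e) else 0ℚ)   ≡⟨ sum-cong-≗ (λ e → if-as-product (dst (α e) == v) (F (α e))) ⟩
      sum (λ e → at-v (dst (α e)) * F (α e))               ≡⟨ into at-v ⟩
      W-u + (W-z + (W-t + W-s))                            ≡⟨ rotate W-u W-z W-t W-s ⟩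
      W-s + (W-u + (W-z + W-t))                            ≡⟨ sym (out-of at-v) ⟩
      sum (λ e → at-v (src (α e)) * F (α e))               ≡⟨ sym (sum-cong-≗ (λ e → if-as-product (src (α e) == v) (F (α e)))) ⟩
      sum (λ e → if src (α e) == v then F (α e) else 0ℚ)   ≡⟨ sym (sumℚ≡sum (λ e → if src (α e) == v then F (α e) else 0ℚ)) ⟩
      outflow (network lam) (F ∘ α) v                      ∎
      where
      open ≡-Reasoning
      open +-*-Solver
      α : Fin (length (network lam)) → Arc Nodes
      α = lookup (network lam)
      at-v : Fin Nodes → ℚ
      at-v w = ind (w == v)
      W-u W-z W-t W-s : ℚ
      W-u = weighted (λ u _ → at-v (vN u))
      W-z = weighted (λ _ z → at-v (zN z))
      W-t = weighted (λ _ _ → at-v tN)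
      W-s = weighted (λ _ _ → at-v sN)
      rotate : ∀ a b c d → a + (b + (c + d)) ≡ d + (a + (b + c))
      rotate = solve 4 (λ a b c d → a :+ (b :+ (c :+ d)) := d :+ (a :+ (b :+ c))) refl

    circulation : Feasible (network lam)
    circulation = F ∘ lookup (network lam) , within-bounds ∘ network-arc lam , conserved

  neighbourhood-supply : ∀ B → sumOver (N B) supply ≡ ℕtoℚ (N⁻ B)
  neighbourhood-supply B = trans (sum-cong-≗ pointwise) (sym (ℕtoℚ-count (InN⁻ B)))
    where
    pointwise : ∀ u → restrict (N B) supply u ≡ restrict (InN⁻ B) (λ _ → 1ℚ) u
    pointwise u with inA G d u
    ... | true  = refl
    ... | false = if-zero _

  feasible⇔coverable : ∀ lam → Feasible (network lam) ⇔ (∀ B → sumOver B (demand lam) ≤ ℕtoℚ (N⁻ B))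
  feasible⇔coverable lam = mk⇔ (demand-bound lam) (FromTransport.circulation lam ∘ transport ∘ admissible)
    where
    admissible : (∀ B → sumOver B (demand lam) ≤ ℕtoℚ (N⁻ B)) → Admissible supply (demand lam)
    admissible coverable = record
      { supply-nonneg = ind-nonneg ∘ inA G d
      ; demand-nonneg = λ z → p≤p⊔q 0ℚ (excess lam z)
      ; hall          = λ B → subst (sumOver B (demand lam) ≤_) (sym (neighbourhood-supply B)) (coverable B)
      }

  sumOver-excess : ∀ lam B → sumOver B (excess lam) ≡ lam * sumSize B - sumSize-1 B
  sumOver-excess lam B = begin
    sumOver B (excess lam)                                ≡⟨ sum-cong-≗ pointwise ⟩
    sum (λ z → lam * restrict B s z - restrict B s-1 z)   ≡⟨ ∑-distrib-- (λ z → lam * restrict B s z) (restrict B s-1) ⟩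
    sum (λ z → lam * restrict B s z) - sumOver B s-1      ≡⟨ cong (_- sumOver B s-1) (sym (*-distribˡ-sum lam (restrict B s))) ⟩
    lam * sumOver B s - sumOver B s-1
      ≡⟨ sym (cong₂ (λ S S₋₁ → lam * S - S₋₁) (sumℚ≡sum (restrict B s)) (sumℚ≡sum (restrict B s-1))) ⟩
    lam * sumSize B - sumSize-1 B                         ∎
    where
    open ≡-Reasoning
    s s-1 : Fin k → ℚ
    s   z = ℕtoℚ (size z)
    s-1 z = ℕtoℚ (size z) - 1ℚ
    pointwise : ∀ z → restrict B (excess lam) z ≡ lam * restrict B s z - restrict B s-1 z
    pointwise z = by-cases (B z)
      where
      open +-*-Solver
      by-cases : ∀ b → (if b then excess lam z else 0ℚ) ≡ lam * (if b then s z else 0ℚ) - (if b then s-1 z else 0ℚ)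
      by-cases true  = solve 2 (λ s l → (s :* l :- s) :+ con 1ℚ := l :* s :- (s :- con 1ℚ)) refl (s z) lam
      by-cases false = sym (cong (_- 0ℚ) (*-zeroʳ lam))

  BoundHolds⇔excess-covered : ∀ lam B → BoundHolds lam B ⇔ sumOver B (excess lam) ≤ ℕtoℚ (N⁻ B)
  BoundHolds⇔excess-covered lam B = mk⇔
    (λ bound → subst₂ _≤_ (sym (sumOver-excess lam B)) (x+y-y≡x _ _) (+-monoˡ-≤ (- sumSize-1 B) bound))
    (λ covered → subst₂ _≤_ (x-y+y≡x _ _) refl (+-monoˡ-≤ (sumSize-1 B) (subst (_≤ _) (sumOver-excess lam B) covered)))

  -- For ⇐, bound the demand of B by that of its pseudonodes with positive excess, which carry all of it.
  coverable⇔bounds : ∀ lam → (∀ B → sumOver B (demand lam) ≤ ℕtoℚ (N⁻ B)) ⇔ (∀ B → BoundHolds lam B)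
  coverable⇔bounds lam = mk⇔
    (λ coverable B → Equivalence.from (BoundHolds⇔excess-covered lam B)
                       (≤-trans (sumOver-monoʳ B (λ z → p≤q⊔p 0ℚ (excess lam z))) (coverable B)))
    (λ bounds B → let B⁺ = λ z → B z ∧ positive? (excess lam z) in begin
       sumOver B (demand lam)                                     ≡⟨ sumOver-cong (λ _ → refl) (0⊔-positive-part ∘ excess lam) ⟩
       sumOver B (restrict (positive? ∘ excess lam) (excess lam)) ≡⟨ sumOver-restrict B (positive? ∘ excess lam) (excess lam) ⟩
       sumOver B⁺ (excess lam)                                    ≤⟨ Equivalence.to (BoundHolds⇔excess-covered lam B⁺) (bounds B⁺) ⟩
       ℕtoℚ (N⁻ B⁺)                                               ≤⟨ N⁻-mono (λ _ → ∧-elimˡ) ⟩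
       ℕtoℚ (N⁻ B)                                                ∎)
    where open ≤-Reasoning

  bounds⇔nonempty-bounds : ∀ lam → (∀ B → BoundHolds lam B) ⇔ (∀ B → NonemptyB B → BoundHolds lam B)
  bounds⇔nonempty-bounds lam = mk⇔ (λ bounds B _ → bounds B) (λ bounds B → by-cases bounds B (anyFin B) refl)
    where
    by-cases : (∀ B → NonemptyB B → BoundHolds lam B) → ∀ B b → anyFin B ≡ b → BoundHolds lam B
    by-cases bounds B true  B≢∅ = bounds B B≢∅
    by-cases bounds B false B≡∅ = Equivalence.from (BoundHolds⇔excess-covered lam B)
                                    (subst (_≤ ℕtoℚ (N⁻ B)) (sym (sumOver-zero B empty)) (ℕtoℚ-nonneg (N⁻ B)))
      where
      empty : ∀ z → B z ≡ true → excess lam z ≡ 0ℚ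
      empty z Bz = ⊥-elim (true≢false (trans (sym Bz) (anyFin-false B B≡∅ z)))

  feasible⇔bounds : ∀ lam → Feasible (network lam) ⇔ (∀ B → NonemptyB B → BoundHolds lam B)
  feasible⇔bounds lam = ⇔.trans (feasible⇔coverable lam) (⇔.trans (coverable⇔bounds lam) (bounds⇔nonempty-bounds lam))

module MaximalLambda {n k : ℕ} (G : Graph n) (d : Fin n → Bool) (cl : Fin n → Fin k)
                     (inhabited : ∀ z → ∃ λ v → (d v ≡ true) × (cl v ≡ z)) where
  open Decomp G d cl
  open EGNetwork G d cl
  open EGNetworkProperties G d cl using (feasible⇔bounds)

  nonempty? : Decidable NonemptyB
  nonempty? B = anyFin B Bool.≟ true

  nonempty-resp : ∀ {B B′} → B ≗ B′ → NonemptyB B → NonemptyB B′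
  nonempty-resp B≗B′ = trans (sym (anyFin-cong B≗B′))

  sumSize-pos : ∀ {B} → NonemptyB B → 0ℚ < sumSize B
  sumSize-pos {B} B≢∅ =
    let z , Bz = anyFin-witness B B≢∅
        v , dv , clv≡z = inhabited z
        v∈z = ∧-intro {d v} dv (trans (cong (_== z) clv≡z) (==-refl z))
    in <-≤-trans (ℕtoℚ-pos (count-pos {p = λ v → d v ∧ (cl v == z)} v v∈z))
                 (subst (ℕtoℚ (size z) ≤_) (sym (sumℚ≡sum (restrict B (ℕtoℚ ∘ size))))
                        (sumOver-≥-term {p = B} (ℕtoℚ-nonneg ∘ size) Bz))

  ratio : (Fin k → Bool) → ℚ
  ratio B = (ℕtoℚ (N⁻ B) + sumSize-1 B) * inverse (sumSize B)

  ratio-spec : ∀ {B} → NonemptyB B → ratio B * sumSize B ≡ ℕtoℚ (N⁻ B) + sumSize-1 B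
  ratio-spec {B} B≢∅ = begin
    X * inverse (sumSize B) * sumSize B     ≡⟨ *-assoc X (inverse (sumSize B)) (sumSize B) ⟩
    X * (inverse (sumSize B) * sumSize B)   ≡⟨ cong (X *_) (inverse-inverseˡ (sumSize-pos B≢∅)) ⟩
    X * 1ℚ                                  ≡⟨ *-identityʳ X ⟩
    X                                       ∎
    where
    open ≡-Reasoning
    X = ℕtoℚ (N⁻ B) + sumSize-1 B

  ratio-cong : ∀ {B B′} → B ≗ B′ → ratio B ≡ ratio B′
  ratio-cong {B} {B′} B≗B′ = cong₂ _*_ (cong₂ _+_ (cong ℕtoℚ N⁻-cong) (sumℚ-cong (λ z → cong (λ b → if b then _ else 0ℚ) (B≗B′ z))))
                                       (cong inverse (sumℚ-cong (λ z → cong (λ b → if b then _ else 0ℚ) (B≗B′ z))))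
    where
    N⁻-cong : N⁻ B ≡ N⁻ B′
    N⁻-cong = count-cong (λ u → cong (inA G d u ∧_) (anyFin-cong (λ z → cong (_∧ adjComp u z) (B≗B′ z))))

  bound⇔≤ratio : ∀ {μ B} → NonemptyB B → BoundHolds μ B ⇔ μ ≤ ratio B
  bound⇔≤ratio {μ} {B} B≢∅ = mk⇔
    (λ bound → *-cancelʳ-≤-pos (sumSize B) {{positive S>0}} (subst (μ * sumSize B ≤_) (sym (ratio-spec B≢∅)) bound))
    (λ μ≤ratio → subst (μ * sumSize B ≤_) (ratio-spec B≢∅) (*-monoʳ-≤-nonNeg (sumSize B) {{nonNegative (<⇒≤ S>0)}} μ≤ratio))
    where
    S>0 : 0ℚ < sumSize B
    S>0 = sumSize-pos B≢∅

  max-feasible⇔tight-bound : ∀ lam → IsMaxFeasible lam ⇔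
    ((∀ B → NonemptyB B → BoundHolds lam B) × ∃ λ B → NonemptyB B × BoundTight lam B)
  max-feasible⇔tight-bound lam = mk⇔ max⇒tight tight⇒max
    where
    max⇒tight : IsMaxFeasible lam → (∀ B → NonemptyB B → BoundHolds lam B) × ∃ λ B → NonemptyB B × BoundTight lam B
    max⇒tight (feasible , maximal) = bounds , tight-set (Family.minimum nonempty? nonempty-resp ratio ratio-cong)
      where
      bounds : ∀ B → NonemptyB B → BoundHolds lam B
      bounds = Equivalence.to (feasible⇔bounds lam) feasible

      tight-set : (∀ B → ¬ NonemptyB B) ⊎ (∃[ B ] NonemptyB B × ∀ B′ → NonemptyB B′ → ratio B ≤ ratio B′) →
                  ∃ λ B → NonemptyB B × BoundTight lam B
      tight-set (inj₁ all-empty) = ⊥-elim (<-irrefl refl (<-≤-trans lam<lam+1 (maximal (lam + 1ℚ) vacuous)))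
        where
        vacuous : Feasible (network (lam + 1ℚ))
        vacuous = Equivalence.from (feasible⇔bounds (lam + 1ℚ)) (λ B B≢∅ → ⊥-elim (all-empty B B≢∅))
        lam<lam+1 : lam < lam + 1ℚ
        lam<lam+1 = subst (_< lam + 1ℚ) (+-identityʳ lam) (+-monoʳ-< lam (positive⁻¹ 1ℚ))
      tight-set (inj₂ (B , B≢∅ , minimal)) = B , B≢∅ , trans (cong (_* sumSize B) lam≡ratio) (ratio-spec B≢∅)
        where
        ratio-feasible : Feasible (network (ratio B))
        ratio-feasible = Equivalence.from (feasible⇔bounds (ratio B))
                           (λ B′ B′≢∅ → Equivalence.from (bound⇔≤ratio B′≢∅) (minimal B′ B′≢∅))
        lam≡ratio : lam ≡ ratio B
        lam≡ratio = ≤-antisym (Equivalence.to (bound⇔≤ratio B≢∅) (bounds B B≢∅)) (maximal (ratio B) ratio-feasible)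

    tight⇒max : (∀ B → NonemptyB B → BoundHolds lam B) × ∃ (λ B → NonemptyB B × BoundTight lam B) → IsMaxFeasible lam
    tight⇒max (bounds , B , B≢∅ , tight) = Equivalence.from (feasible⇔bounds lam) bounds ,
      λ μ feasibleμ → *-cancelʳ-≤-pos (sumSize B) {{positive (sumSize-pos B≢∅)}}
                        (subst (μ * sumSize B ≤_) (sym tight) (Equivalence.to (feasible⇔bounds μ) feasibleμ B B≢∅))

lemma4 : ∀ {n} (G : Graph n) (d : Fin n → Bool)
         → (∀ v → (d v ≡ true) ⇔ InD G v)
         → ∀ k (cl : Fin n → Fin k) → IsComponentLabelling G d cl
         → ∀ (lam : ℚ)
         → EGNetwork.IsMaxFeasible G d cl lam
           ⇔ ((∀ B → EGNetwork.NonemptyB G d cl B → EGNetwork.BoundHolds G d cl lam B)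
              × ∃ λ B → EGNetwork.NonemptyB G d cl B × EGNetwork.BoundTight G d cl lam B)
lemma4 G d _ k cl (_ , inhabited) = MaximalLambda.max-feasible⇔tight-bound G d cl inhabited
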